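{- Let $n\ge1$, $0\le h\le n-1$, $q=\max\{e^{ -e^{ -h/n}}-h/n,0\}$ with $qn$ an integer, and run Algorithm 3 in the $h$-RO-SP. For every $\ell$ with $n-h\le\ell\le n$ and every $U_\ell\subseteq C$ with $|U_\ell|=h+\ell$, $$\Pr\Big[\bigwedge_{k=qn+1}^{\ell}\neg\mathcal{M}_k\ \Big|\ S_\ell=U_\ell\Big]=\frac{h+qn}{n}\left(1-\frac1n\right)^{\ell-(n-h)}.$$
   Context: The $h$-RO-SP, for integers $n\ge1$, $h\ge0$: an adversary picks a set $C$ of $n+h$ candidates with values in $\mathbb{R}_{\ge0}$ (totally ordered, ties broken consistently). A uniformly random $H\subseteq C$ of size $h$ is given to the player upfront together with $n$; the candidates of $O=C\setminus H$ arrive one by one in uniformly random order $c_1,\dots,c_n$, each irrevocably accepted or rejected on arrival; accepting terminates. $S_\ell=H\cup\{c_1,\dots,c_\ell\}$ and $\mathcal{M}_k$ is the event that $c_k$ is accepted by the algorithm. Probabilities are over $H$, the random order and the algorithm's randomness. Algorithm 3: $T_0\leftarrow H$. At round $\ell$: $T_\ell\leftarrow T_{\ell-1}\cup\{c_\ell\}$. If $\ell\le qn$, reject. Else if $|T_\ell|\le n$, accept and terminate iff $c_\ell=\max T_\ell$. Else draw a uniformly random $X_\ell\subseteq T_{\ell-1}$ of cardinality $n-1$ and accept and terminate iff $c_\ell>\max X_\ell$. -}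

module Defs where

open import Data.Bool using (Bool; true; false; _∧_; _∨_; not; if_then_else_)
open import Data.Nat using (ℕ; zero; suc; _+_; _*_; _∸_; _≤ᵇ_; _<ᵇ_)
open import Data.Fin using (Fin; toℕ)
open import Data.Fin.Subset using (Subset; _∪_; ⁅_⁆; ∣_∣; ⊥)
open import Data.List using (List; []; _∷_; filterᵇ; allFin; length; take; map; foldr)
open import Data.Bool.ListAction using (all; any)
open import Data.Vec using (Vec; lookup) renaming ([] to []ᵥ; _∷_ to _∷ᵥ_)
open import Data.Integer using (+_)
open import Data.Rational using (ℚ; 0ℚ; 1ℚ; _/_) renaming (_+_ to _+ℚ_; _*_ to _*ℚ_; _-_ to _-ℚ_)

allVecs : {A : Set} → List A → (k : ℕ) → List (Vec A k)
allVecs xs zero    = []ᵥ ∷ []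
allVecs xs (suc k) = foldr (λ x acc → map (x ∷ᵥ_) (allVecs xs k) Data.List.++ acc) [] xs

allLists : {A : Set} → List A → (k : ℕ) → List (List A)
allLists xs zero    = [] ∷ []
allLists xs (suc k) = foldr (λ x acc → map (x ∷_) (allLists xs k) Data.List.++ acc) [] xs

allSubsets : (N : ℕ) → List (Subset N)
allSubsets N = allVecs (true ∷ false ∷ []) N

-- exact rational fraction a / b (0 if b = 0; only used with b ≠ 0)
frac : ℕ → ℕ → ℚ
frac a zero    = 0ℚ
frac a (suc b) = (+ a) / suc b

sumℚ : List ℚ → ℚ
sumℚ = foldr _+ℚ_ 0ℚ

-- arithmetic mean of a list (uniform expectation); 0 for the empty list
mean : List ℚ → ℚ
mean []         = 0ℚ
mean xs@(_ ∷ _) = sumℚ xs *ℚ frac 1 (length xs)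

powℚ : ℚ → ℕ → ℚ
powℚ p zero    = 1ℚ
powℚ p (suc k) = p *ℚ powℚ p k

-- Candidates: C = Fin N with N = n + h, totally ordered by index
-- (only the relative order of values matters to the algorithm).

module _ {N : ℕ} where

  _<F_ : Fin N → Fin N → Bool
  x <F y = toℕ x <ᵇ toℕ y

  _==F_ : Fin N → Fin N → Bool
  x ==F y = toℕ x Data.Nat.≡ᵇ toℕ y

  elems : Subset N → List (Fin N)
  elems T = filterᵇ (lookup T) (allFin N)

  _∈ᵇ_ : Fin N → Subset N → Bool
  x ∈ᵇ T = lookup T x

  _⊆ᵇ_ : Subset N → Subset N → Bool
  X ⊆ᵇ T = all (λ x → x ∈ᵇ T) (elems X)

  eqSubset : Subset N → Subset N → Bool
  eqSubset X Y = (X ⊆ᵇ Y) ∧ (Y ⊆ᵇ X)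

  fromList : List (Fin N) → Subset N
  fromList = foldr (λ x T → ⁅ x ⁆ ∪ T) ⊥

  distinct : List (Fin N) → Bool
  distinct []       = true
  distinct (x ∷ xs) = not (any (x ==F_) xs) ∧ distinct xs

  -- c is the maximum of T (c ∈ T assumed)
  isMax : Fin N → Subset N → Bool
  isMax c T = all (λ x → (x <F c) ∨ (x ==F c)) (elems T)

  aboveAll : Fin N → Subset N → Bool
  aboveAll c X = all (λ x → x <F c) (elems X)

  subsetsOfSize : ℕ → Subset N → List (Subset N)
  subsetsOfSize k T = filterᵇ (λ X → (X ⊆ᵇ T) ∧ (∣ X ∣ Data.Nat.≡ᵇ k)) (allSubsets N)

-- The h-RO-SP sample space: outcomes (H , (c₁,…,cₙ)) with H ⊆ C of size h
-- and c₁,…,cₙ an ordering of C \ H.  Uniform over this list =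
-- uniform random H and, independently, uniform random arrival order.

open import Data.Product using (_×_; _,_; proj₁; proj₂)

outcomes : (n h : ℕ) → List (Subset (n + h) × List (Fin (n + h)))
outcomes n h =
  filterᵇ (λ ω → (∣ proj₁ ω ∣ Data.Nat.≡ᵇ h)
               ∧ distinct (proj₂ ω)
               ∧ not (any (λ c → c ∈ᵇ proj₁ ω) (proj₂ ω)))
    (Data.List.cartesianProduct (allSubsets (n + h)) (allLists (allFin (n + h)) n))

Sℓ : {N : ℕ} → Subset N × List (Fin N) → ℕ → Subset N
Sℓ (H , cs) ℓ = H ∪ fromList (take ℓ cs)

-- Algorithm 3 with threshold m = qn.
-- rejectProb n m k T c : probability (over X_k) that round k rejects,
-- where T = T_{k-1} and c = c_k.

rejectProb : {N : ℕ} → (n m k : ℕ) → Subset N → Fin N → ℚ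
rejectProb n m k T c =
  if k ≤ᵇ m then 1ℚ
  else if ∣ T ∪ ⁅ c ⁆ ∣ ≤ᵇ n then (if isMax c (T ∪ ⁅ c ⁆) then 0ℚ else 1ℚ)
  else frac (length (filterᵇ (λ X → not (aboveAll c X)) (subsetsOfSize (n ∸ 1) T)))
            (length (subsetsOfSize (n ∸ 1) T))

-- probability (over the independent draws X_k) that rounds k, k+1, … reject
-- every candidate in the given list, starting from T = T_{k-1}
rejectAll : {N : ℕ} → (n m k : ℕ) → Subset N → List (Fin N) → ℚ
rejectAll n m k T []       = 1ℚ
rejectAll n m k T (c ∷ cs) = rejectProb n m k T c *ℚ rejectAll n m (suc k) (T ∪ ⁅ c ⁆) cs

-- Pr[ no 𝓜_k for k = 1,…,ℓ | H, order ]  (rounds k ≤ m reject surely, so this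
-- equals Pr[ ⋀_{k=m+1}^{ℓ} ¬𝓜_k | H, order ])
noAcceptUpTo : (n h m : ℕ) → Subset (n + h) × List (Fin (n + h)) → ℕ → ℚ
noAcceptUpTo n h m (H , cs) ℓ = rejectAll n m 1 H (take ℓ cs)

-- Pr[ ⋀_{k=m+1}^{ℓ} ¬𝓜_k | S_ℓ = U ]  (all outcomes equally likely)
condProbNoAccept : (n h m ℓ : ℕ) → Subset (n + h) → ℚ
condProbNoAccept n h m ℓ U =
  mean (map (λ ω → noAcceptUpTo n h m ω ℓ)
            (filterᵇ (λ ω → eqSubset (Sℓ ω ℓ) U) (outcomes n h)))

module Submission where

-- Proof strategy.  All probabilities in Defs are exact averages over an explicit
-- enumeration, so the theorem is a counting identity over ℚ.
--
-- 1. Conditioning.  An outcome (H , c₁ … cₙ) with S_ℓ = U is a prefix path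
--    (H , c₁ … c_ℓ) with H ∪ {c₁ … c_ℓ} = U followed by an ordering of C ∖ U;
--    the number K of such suffixes does not depend on the path, so the
--    conditional probability is (rejection path sum)·K / ((number of paths)·K).
-- 2. Path sums peel off the last arrival c ∈ U, which round ℓ sees with
--    T_{ℓ-1} = U ∖ {c}.  Hence there are (h+1)⋯(h+ℓ) paths, and the rejection
--    path sum is R₁⋯R_ℓ with Rₖ = Σ_{c ∈ U} Pr[round k rejects c | T_{k-1} = U ∖ {c}].
-- 3. Round sums.  Rₖ = h + k for k ≤ m; Rₖ = h + k - 1 (only the maximum is
--    accepted) while h + k ≤ n; otherwise Rₖ = (h + k)(1 - 1/n), by counting the
--    (n-1)-subsets X of U ∖ {c} with c > max X: summed over c they are the
--    n-subsets of U, and n·C(s+1, n) = (s+1)·C(s, n-1).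
-- 4. The ratio R₁⋯R_ℓ / (h+1)⋯(h+ℓ) telescopes to (h+m)/n · (1 - 1/n)^(ℓ-(n-h)).

module Proof where
  open import Data.Bool using (Bool; T; true; false; _∧_; _∨_; not; if_then_else_)
  open import Data.Bool.Properties using (∧-identityʳ; ∨-assoc; ∨-identityʳ; ∨-zeroʳ)
  open import Data.Bool.ListAction using (all; any)
  open import Data.Empty using (⊥-elim) renaming (⊥ to Empty)
  open import Data.Fin using (Fin; zero; suc; toℕ)
  import Data.Fin.Properties as FinP
  open import Data.Fin.Subset using (Subset; _∪_; ⁅_⁆; ∣_∣; ⊥)
  import Data.Fin.Subset.Properties as SubsetP
  import Data.Integer as ℤ
  import Data.Integer.Properties as ℤP
  open import Data.List using (List; []; _∷_; _++_; allFin; cartesianProduct; drop; filterᵇ; foldr; length; map; tabulate; take)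
  import Data.List.Properties as ListP
  open import Data.Nat as ℕ using (ℕ; zero; suc; _∸_)
  import Data.Nat.Properties as ℕP
  open import Data.Product using (_×_; _,_; proj₁; proj₂; ∃)
  open import Data.Rational using (ℚ; 0ℚ; 1ℚ; _+_; _*_; _-_; _/_; fromℚᵘ; toℚᵘ)
  open import Data.Rational.Properties
  open import Data.Rational.Solver using (module +-*-Solver)
  import Data.Rational.Unnormalised as ℚᵘ
  import Data.Rational.Unnormalised.Properties as ℚᵘP
  open import Data.Sum using (inj₁; inj₂)
  open import Data.Vec using ([]; _∷_; lookup)
  import Data.Vec.Properties as VecP
  open import Relation.Binary.PropositionalEquality
  open import Defs
  open +-*-Solver

  opaque
    ι : ℕ → ℚ
    ι a = ℤ.+ a / 1

  ιᵘ : ℕ → ℚᵘ.ℚᵘ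
  ιᵘ a = ℚᵘ.mkℚᵘ (ℤ.+ a) 0

  fromℚᵘ-homo-+ : ∀ x y → fromℚᵘ x + fromℚᵘ y ≡ fromℚᵘ (x ℚᵘ.+ y)
  fromℚᵘ-homo-+ x y = toℚᵘ-injective (ℚᵘP.≃-trans (toℚᵘ-homo-+ (fromℚᵘ x) (fromℚᵘ y))
    (ℚᵘP.≃-trans (ℚᵘP.+-cong (toℚᵘ-fromℚᵘ x) (toℚᵘ-fromℚᵘ y)) (ℚᵘP.≃-sym (toℚᵘ-fromℚᵘ (x ℚᵘ.+ y)))))

  fromℚᵘ-homo-* : ∀ x y → fromℚᵘ x * fromℚᵘ y ≡ fromℚᵘ (x ℚᵘ.* y)
  fromℚᵘ-homo-* x y = toℚᵘ-injective (ℚᵘP.≃-trans (toℚᵘ-homo-* (fromℚᵘ x) (fromℚᵘ y))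
    (ℚᵘP.≃-trans (ℚᵘP.*-cong (toℚᵘ-fromℚᵘ x) (toℚᵘ-fromℚᵘ y)) (ℚᵘP.≃-sym (toℚᵘ-fromℚᵘ (x ℚᵘ.* y)))))

  opaque
    unfolding ι

    ι-0 : ι 0 ≡ 0ℚ
    ι-0 = refl

    ι-1 : ι 1 ≡ 1ℚ
    ι-1 = refl

    ι-+ : ∀ a b → ι (a ℕ.+ b) ≡ ι a + ι b
    ι-+ a b = trans (fromℚᵘ-cong {ιᵘ (a ℕ.+ b)} {ιᵘ a ℚᵘ.+ ιᵘ b} (ℚᵘ.*≡* cross)) (sym (fromℚᵘ-homo-+ (ιᵘ a) (ιᵘ b)))
      where
      cross : ℤ.+ (a ℕ.+ b) ℤ.* ℤ.+ 1 ≡ (ℤ.+ a ℤ.* ℤ.+ 1 ℤ.+ ℤ.+ b ℤ.* ℤ.+ 1) ℤ.* ℤ.+ 1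
      cross rewrite ℤP.*-identityʳ (ℤ.+ a) | ℤP.*-identityʳ (ℤ.+ b) = refl

    ι-* : ∀ a b → ι (a ℕ.* b) ≡ ι a * ι b
    ι-* a b = trans (fromℚᵘ-cong {ιᵘ (a ℕ.* b)} {ιᵘ a ℚᵘ.* ιᵘ b} (ℚᵘ.*≡* cross)) (sym (fromℚᵘ-homo-* (ιᵘ a) (ιᵘ b)))
      where
      cross : ℤ.+ (a ℕ.* b) ℤ.* ℤ.+ 1 ≡ (ℤ.+ a ℤ.* ℤ.+ b) ℤ.* ℤ.+ 1
      cross rewrite sym (ℤP.pos-* a b) = refl

    ι-injective : ∀ a b → ι a ≡ ι b → a ≡ b
    ι-injective a b e with ℚᵘP.≃-trans (ℚᵘP.≃-sym (toℚᵘ-fromℚᵘ (ιᵘ a)))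
                             (ℚᵘP.≃-trans (ℚᵘP.≃-reflexive (cong toℚᵘ e)) (toℚᵘ-fromℚᵘ (ιᵘ b)))
    ... | ℚᵘ.*≡* cross = ℤP.+-injective (trans (sym (ℤP.*-identityʳ (ℤ.+ a))) (trans cross (ℤP.*-identityʳ (ℤ.+ b))))

    frac-cancel : ∀ a d → frac a (suc d) * ι (suc d) ≡ ι a
    frac-cancel a d = trans (fromℚᵘ-homo-* (ℚᵘ.mkℚᵘ (ℤ.+ a) d) (ιᵘ (suc d))) (fromℚᵘ-cong {ℚᵘ.mkℚᵘ (ℤ.+ a) d ℚᵘ.* ιᵘ (suc d)} {ιᵘ a} (ℚᵘ.*≡* cross))
      where
      cross : (ℤ.+ a ℤ.* ℤ.+ suc d) ℤ.* ℤ.+ 1 ≡ ℤ.+ a ℤ.* ℤ.+ suc (d ℕ.* 1)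
      cross rewrite ℤP.*-identityʳ (ℤ.+ a ℤ.* ℤ.+ suc d) | ℕP.*-identityʳ d = refl

  frac-inverse : ∀ d → frac 1 (suc d) * ι (suc d) ≡ 1ℚ
  frac-inverse d = trans (frac-cancel 1 d) ι-1

  pos⇒suc : ∀ D → 1 ℕ.≤ D → ∃ λ d → D ≡ suc d
  pos⇒suc (suc d) _ = d , refl

  -- Finite sums over lists, and the indicator weight  ind b x = (b ? x : 0),
  -- which turns a filtered sum into a weighted sum over the whole list.

  Σ : {A : Set} → List A → (A → ℚ) → ℚ
  Σ xs f = sumℚ (map f xs)

  ind : Bool → ℚ → ℚ
  ind b x = if b then x else 0ℚ

  ind-∧ : ∀ a b x → ind (a ∧ b) x ≡ ind a (ind b x)
  ind-∧ true  b x = refl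
  ind-∧ false b x = refl

  ind-0 : ∀ b → ind b 0ℚ ≡ 0ℚ
  ind-0 true  = refl
  ind-0 false = refl

  ind-+ : ∀ b x y → ind b (x + y) ≡ ind b x + ind b y
  ind-+ true  x y = refl
  ind-+ false x y = refl

  ind-*ˡ : ∀ b k x → ind b (k * x) ≡ k * ind b x
  ind-*ˡ true  k x = refl
  ind-*ˡ false k x = sym (*-zeroʳ k)

  ind-*ʳ : ∀ b x k → ind b (x * k) ≡ ind b x * k
  ind-*ʳ true  x k = refl
  ind-*ʳ false x k = sym (*-zeroˡ k)

  ind-*-ind : ∀ a b x → ind a x * ind b 1ℚ ≡ ind (a ∧ b) x
  ind-*-ind true  true  x = *-identityʳ x
  ind-*-ind true  false x = *-zeroʳ x
  ind-*-ind false b     x = *-zeroˡ (ind b 1ℚ)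

  ind-not+ind : ∀ a q → ind a (ind (not q) 1ℚ) + ind a (ind q 1ℚ) ≡ ind a 1ℚ
  ind-not+ind true  true  = +-identityˡ _
  ind-not+ind true  false = +-identityʳ _
  ind-not+ind false q     = +-identityˡ _

  ind-congᵇ : ∀ {b} {x y : ℚ} → (b ≡ true → x ≡ y) → ind b x ≡ ind b y
  ind-congᵇ {true}  e = e refl
  ind-congᵇ {false} e = refl

  module _ {A : Set} where

    Σ-++ : ∀ (xs ys : List A) f → Σ (xs ++ ys) f ≡ Σ xs f + Σ ys f
    Σ-++ []       ys f = sym (+-identityˡ _)
    Σ-++ (x ∷ xs) ys f = trans (cong (f x +_) (Σ-++ xs ys f)) (sym (+-assoc (f x) _ _))

    Σ-cong : ∀ (xs : List A) {f g} → (∀ x → f x ≡ g x) → Σ xs f ≡ Σ xs g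
    Σ-cong []       e = refl
    Σ-cong (x ∷ xs) e = cong₂ _+_ (e x) (Σ-cong xs e)

    Σ-+ : ∀ (xs : List A) f g → Σ xs (λ x → f x + g x) ≡ Σ xs f + Σ xs g
    Σ-+ []       f g = refl
    Σ-+ (x ∷ xs) f g rewrite Σ-+ xs f g =
      solve 4 (λ a b c d → (a :+ b) :+ (c :+ d) := (a :+ c) :+ (b :+ d)) refl (f x) (g x) (Σ xs f) (Σ xs g)

    Σ-*ˡ : ∀ (xs : List A) c f → Σ xs (λ x → c * f x) ≡ c * Σ xs f
    Σ-*ˡ []       c f = sym (*-zeroʳ c)
    Σ-*ˡ (x ∷ xs) c f rewrite Σ-*ˡ xs c f = sym (*-distribˡ-+ c (f x) (Σ xs f))

    Σ-*ʳ : ∀ (xs : List A) c f → Σ xs (λ x → f x * c) ≡ Σ xs f * c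
    Σ-*ʳ xs c f = trans (Σ-cong xs (λ x → *-comm (f x) c)) (trans (Σ-*ˡ xs c f) (*-comm c _))

    Σ-zero : ∀ (xs : List A) → Σ xs (λ _ → 0ℚ) ≡ 0ℚ
    Σ-zero []       = refl
    Σ-zero (x ∷ xs) rewrite Σ-zero xs = refl

    Σ-ind : ∀ (xs : List A) b f → Σ xs (λ x → ind b (f x)) ≡ ind b (Σ xs f)
    Σ-ind xs true  f = refl
    Σ-ind xs false f = Σ-zero xs

    Σ-filter : ∀ (xs : List A) p f → Σ (filterᵇ p xs) f ≡ Σ xs (λ x → ind (p x) (f x))
    Σ-filter []       p f = refl
    Σ-filter (x ∷ xs) p f with p x
    ... | true  = cong (f x +_) (Σ-filter xs p f)
    ... | false = trans (Σ-filter xs p f) (sym (+-identityˡ _))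

    Σ-length : ∀ (xs : List A) → ι (length xs) ≡ Σ xs (λ _ → 1ℚ)
    Σ-length []       = ι-0
    Σ-length (x ∷ xs) = trans (ι-+ 1 (length xs)) (cong₂ _+_ ι-1 (Σ-length xs))

    length-filter : ∀ p (xs : List A) → ι (length (filterᵇ p xs)) ≡ Σ xs (λ x → ind (p x) 1ℚ)
    length-filter p xs = trans (Σ-length (filterᵇ p xs)) (Σ-filter xs p (λ _ → 1ℚ))

  Σ-swap : ∀ {A B : Set} (xs : List A) (ys : List B) (f : A → B → ℚ) →
    Σ xs (λ x → Σ ys (f x)) ≡ Σ ys (λ y → Σ xs (λ x → f x y))
  Σ-swap []       ys f = sym (Σ-zero ys)
  Σ-swap (x ∷ xs) ys f =
    trans (cong (Σ ys (f x) +_) (Σ-swap xs ys f)) (sym (Σ-+ ys (f x) (λ y → Σ xs (λ x → f x y))))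

  Σ-map : ∀ {A B : Set} (g : A → B) (xs : List A) f → Σ (map g xs) f ≡ Σ xs (λ x → f (g x))
  Σ-map g []       f = refl
  Σ-map g (x ∷ xs) f = cong (f (g x) +_) (Σ-map g xs f)

  Σ-cartesian : ∀ {A B : Set} (xs : List A) (ys : List B) f →
    Σ (cartesianProduct xs ys) f ≡ Σ xs (λ x → Σ ys (λ y → f (x , y)))
  Σ-cartesian []       ys f = refl
  Σ-cartesian (x ∷ xs) ys f =
    trans (Σ-++ (map (x ,_) ys) _ f) (cong₂ _+_ (Σ-map (x ,_) ys f) (Σ-cartesian xs ys f))

  sumFin : (N : ℕ) → (Fin N → ℚ) → ℚ
  sumFin zero    f = 0ℚ
  sumFin (suc N) f = f zero + sumFin N (λ i → f (suc i))

  Σ-tabulate : ∀ {A : Set} N (g : Fin N → A) f → Σ (tabulate g) f ≡ sumFin N (λ i → f (g i))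
  Σ-tabulate zero    g f = refl
  Σ-tabulate (suc N) g f = cong (f (g zero) +_) (Σ-tabulate N (λ i → g (suc i)) f)

  Σ-allFin : ∀ N f → Σ (allFin N) f ≡ sumFin N f
  Σ-allFin N = Σ-tabulate N (λ i → i)

  sumFin-cong : ∀ N {f g : Fin N → ℚ} → (∀ i → f i ≡ g i) → sumFin N f ≡ sumFin N g
  sumFin-cong zero    e = refl
  sumFin-cong (suc N) e = cong₂ _+_ (e zero) (sumFin-cong N (λ i → e (suc i)))

  sumFin-restrict : ∀ {N} (p : Fin N → Bool) (F G : Fin N → ℚ) → (∀ c → p c ≡ true → F c ≡ G c) →
    sumFin N (λ c → ind (p c) (F c)) ≡ sumFin N (λ c → ind (p c) (G c))
  sumFin-restrict {N} p F G e = sumFin-cong N (λ c → ind-congᵇ (e c))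

  sumFin-zero : ∀ N → sumFin N (λ _ → 0ℚ) ≡ 0ℚ
  sumFin-zero zero    = refl
  sumFin-zero (suc N) = trans (+-identityˡ _) (sumFin-zero N)

  sumFin-+ : ∀ N (f g : Fin N → ℚ) → sumFin N (λ i → f i + g i) ≡ sumFin N f + sumFin N g
  sumFin-+ zero    f g = sym (+-identityˡ 0ℚ)
  sumFin-+ (suc N) f g rewrite sumFin-+ N (λ i → f (suc i)) (λ i → g (suc i)) =
    solve 4 (λ a b c d → (a :+ b) :+ (c :+ d) := (a :+ c) :+ (b :+ d)) refl
      (f zero) (g zero) (sumFin N (λ i → f (suc i))) (sumFin N (λ i → g (suc i)))

  sumFin-*ˡ : ∀ N k (f : Fin N → ℚ) → sumFin N (λ i → k * f i) ≡ k * sumFin N f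
  sumFin-*ˡ zero    k f = sym (*-zeroʳ k)
  sumFin-*ˡ (suc N) k f rewrite sumFin-*ˡ N k (λ i → f (suc i)) = sym (*-distribˡ-+ k _ _)

  sumFin-*ʳ : ∀ N k (f : Fin N → ℚ) → sumFin N (λ i → f i * k) ≡ sumFin N f * k
  sumFin-*ʳ N k f = trans (sumFin-cong N (λ i → *-comm (f i) k)) (trans (sumFin-*ˡ N k f) (*-comm k _))

  module _ {A : Set} (xs : List A) where

    private
      Σ-prepend : ∀ (L : List (List A)) (ys : List A) F →
        Σ (foldr (λ x acc → map (x ∷_) L ++ acc) [] ys) F ≡ Σ ys (λ x → Σ L (λ cs → F (x ∷ cs)))
      Σ-prepend L []       F = refl
      Σ-prepend L (y ∷ ys) F =
        trans (Σ-++ (map (y ∷_) L) _ F) (cong₂ _+_ (Σ-map (y ∷_) L F) (Σ-prepend L ys F))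

    Σ-words-suc : ∀ k F → Σ (allLists xs (suc k)) F ≡ Σ xs (λ x → Σ (allLists xs k) (λ cs → F (x ∷ cs)))
    Σ-words-suc k F = Σ-prepend (allLists xs k) xs F

    Σ-words-split : ∀ a b (G : List A → List A → ℚ) →
      Σ (allLists xs (a ℕ.+ b)) (λ cs → G (take a cs) (drop a cs))
        ≡ Σ (allLists xs a) (λ as → Σ (allLists xs b) (G as))
    Σ-words-split zero    b G = sym (+-identityʳ _)
    Σ-words-split (suc a) b G =
      trans (Σ-words-suc (a ℕ.+ b) _)
        (trans (Σ-cong xs (λ x → Σ-words-split a b (λ as → G (x ∷ as))))
          (sym (Σ-words-suc a _)))

    Σ-words-length : ∀ k F → Σ (allLists xs k) F ≡ Σ (allLists xs k) (λ cs → ind (length cs ℕ.≡ᵇ k) (F cs))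
    Σ-words-length zero    F = refl
    Σ-words-length (suc k) F =
      trans (Σ-words-suc k F)
        (trans (Σ-cong xs (λ x → Σ-words-length k (λ cs → F (x ∷ cs)))) (sym (Σ-words-suc k _)))

    Σ-words-snoc : ∀ ℓ (F : List A → ℚ) →
      Σ (allLists xs (suc ℓ)) F ≡ Σ (allLists xs ℓ) (λ as → Σ xs (λ c → F (as ++ c ∷ [])))
    Σ-words-snoc ℓ F =
      trans (Σ-cong (allLists xs (suc ℓ)) (λ cs → cong F (sym (ListP.take++drop≡id ℓ cs))))
        (trans (subst (λ k → Σ (allLists xs k) (λ cs → F (take ℓ cs ++ drop ℓ cs))
                            ≡ Σ (allLists xs ℓ) (λ as → Σ (allLists xs 1) (λ bs → F (as ++ bs))))
                      (ℕP.+-comm ℓ 1) (Σ-words-split ℓ 1 (λ as bs → F (as ++ bs))))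
          (Σ-cong (allLists xs ℓ) (λ as → trans (Σ-words-suc 0 (λ bs → F (as ++ bs)))
            (Σ-cong xs (λ c → +-identityʳ _)))))

  ∧-true-l : ∀ {a b} → a ∧ b ≡ true → a ≡ true
  ∧-true-l {true} e = refl

  ∧-true-r : ∀ {a b} → a ∧ b ≡ true → b ≡ true
  ∧-true-r {true} e = e

  ∧-true : ∀ {a b} → a ≡ true → b ≡ true → a ∧ b ≡ true
  ∧-true refl refl = refl

  not-true : ∀ {a} → not a ≡ true → a ≡ false
  not-true {false} e = refl

  not-false : ∀ {a} → a ≡ false → not a ≡ true
  not-false refl = refl

  ∧-false : ∀ a → a ∧ false ≡ false
  ∧-false true  = refl
  ∧-false false = refl

  bool-ext : ∀ {a b} → (a ≡ true → b ≡ true) → (b ≡ true → a ≡ true) → a ≡ b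
  bool-ext {true}          f g = sym (f refl)
  bool-ext {false} {true}  f g = g refl
  bool-ext {false} {false} f g = refl

  T⇒≡true : ∀ {b} → T b → b ≡ true
  T⇒≡true {true} _ = refl

  ≡true⇒T : ∀ {b} → b ≡ true → T b
  ≡true⇒T refl = _

  ≤ᵇ-true : ∀ {a b} → a ℕ.≤ b → (a ℕ.≤ᵇ b) ≡ true
  ≤ᵇ-true le = T⇒≡true (ℕP.≤⇒≤ᵇ le)

  ≤ᵇ-false : ∀ {a b} → b ℕ.< a → (a ℕ.≤ᵇ b) ≡ false
  ≤ᵇ-false {a} {b} lt with a ℕ.≤ᵇ b in e
  ... | true  = ⊥-elim (ℕP.<⇒≱ lt (ℕP.≤ᵇ⇒≤ a b (≡true⇒T e)))
  ... | false = refl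

  ≤ᵇ-false⇒> : ∀ {a b} → (a ℕ.≤ᵇ b) ≡ false → b ℕ.< a
  ≤ᵇ-false⇒> {a} {b} e = ℕP.≰⇒> (λ le → true≢false (trans (sym (≤ᵇ-true le)) e))
    where
    true≢false : true ≡ false → Empty
    true≢false ()

  ≡ᵇ-refl : ∀ m → (m ℕ.≡ᵇ m) ≡ true
  ≡ᵇ-refl m = T⇒≡true (ℕP.≡⇒≡ᵇ m m refl)

  ==F⇒≡ : ∀ {N} (i j : Fin N) → (i ==F j) ≡ true → i ≡ j
  ==F⇒≡ i j e = FinP.toℕ-injective (ℕP.≡ᵇ⇒≡ (toℕ i) (toℕ j) (≡true⇒T e))

  ==F-refl : ∀ {N} (i : Fin N) → (i ==F i) ≡ true
  ==F-refl i = ≡ᵇ-refl (toℕ i)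

  ==F-sym : ∀ {N} (i j : Fin N) → (i ==F j) ≡ (j ==F i)
  ==F-sym i j = bool-ext (λ e → subst (λ k → (k ==F i) ≡ true) (==F⇒≡ i j e) (==F-refl i))
                         (λ e → subst (λ k → (k ==F j) ≡ true) (==F⇒≡ j i e) (==F-refl j))

  lookup-∪ : ∀ {N} (A B : Subset N) i → lookup (A ∪ B) i ≡ (lookup A i ∨ lookup B i)
  lookup-∪ A B i = VecP.lookup-zipWith _∨_ i A B

  lookup-⊥ : ∀ {N} (i : Fin N) → lookup (⊥ {N}) i ≡ false
  lookup-⊥ i = VecP.lookup-replicate i false

  lookup-⁅⁆ : ∀ {N} (x i : Fin N) → lookup ⁅ x ⁆ i ≡ (i ==F x)
  lookup-⁅⁆ zero    zero    = refl
  lookup-⁅⁆ zero    (suc i) = lookup-⊥ i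
  lookup-⁅⁆ (suc x) zero    = refl
  lookup-⁅⁆ (suc x) (suc i) = lookup-⁅⁆ x i

  lookup-fromList : ∀ {N} (as : List (Fin N)) i → lookup (fromList as) i ≡ any (i ==F_) as
  lookup-fromList []       i = lookup-⊥ i
  lookup-fromList (a ∷ as) i =
    trans (lookup-∪ ⁅ a ⁆ (fromList as) i) (cong₂ _∨_ (lookup-⁅⁆ a i) (lookup-fromList as i))

  lookup-∪-fromList : ∀ {N} (H : Subset N) as i → lookup (H ∪ fromList as) i ≡ (lookup H i ∨ any (i ==F_) as)
  lookup-∪-fromList H as i = trans (lookup-∪ H (fromList as) i) (cong (lookup H i ∨_) (lookup-fromList as i))

  subset-ext : ∀ {N} (A B : Subset N) → (∀ i → lookup A i ≡ lookup B i) → A ≡ B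
  subset-ext A B e = trans (sym (VecP.tabulate∘lookup A)) (trans (VecP.tabulate-cong e) (VecP.tabulate∘lookup B))

  remove : ∀ {N} → Subset N → Fin N → Subset N
  remove (b ∷ U) zero    = false ∷ U
  remove (b ∷ U) (suc c) = b ∷ remove U c

  lookup-remove : ∀ {N} (U : Subset N) c i → lookup (remove U c) i ≡ (not (i ==F c) ∧ lookup U i)
  lookup-remove (b ∷ U) zero    zero    = refl
  lookup-remove (b ∷ U) zero    (suc i) = refl
  lookup-remove (b ∷ U) (suc c) zero    = refl
  lookup-remove (b ∷ U) (suc c) (suc i) = lookup-remove U c i

  remove-∪-⁅⁆ : ∀ {N} (U : Subset N) c → lookup U c ≡ true → remove U c ∪ ⁅ c ⁆ ≡ U
  remove-∪-⁅⁆ U c uc = subset-ext _ _ pointwise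
    where
    pointwise : ∀ i → lookup (remove U c ∪ ⁅ c ⁆) i ≡ lookup U i
    pointwise i rewrite lookup-∪ (remove U c) ⁅ c ⁆ i | lookup-remove U c i | lookup-⁅⁆ c i with i ==F c in e
    ... | true with ==F⇒≡ i c e
    ...   | refl = trans (∨-zeroʳ (not true ∧ lookup U i)) (sym uc)
    pointwise i | false = ∨-identityʳ _

  ∣∷∣ : ∀ {N} b (T : Subset N) → ∣ b ∷ T ∣ ≡ (if b then suc ∣ T ∣ else ∣ T ∣)
  ∣∷∣ true  T = refl
  ∣∷∣ false T = refl

  ∣remove∣ : ∀ {N} (U : Subset N) c → lookup U c ≡ true → suc ∣ remove U c ∣ ≡ ∣ U ∣
  ∣remove∣ (true ∷ U) zero e = refl
  ∣remove∣ (b ∷ U) (suc c) e rewrite ∣∷∣ b (remove U c) | ∣∷∣ b U with b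
  ... | true  = cong suc (∣remove∣ U c e)
  ... | false = ∣remove∣ U c e

  ∣∪⁅⁆∣ : ∀ {N} (V : Subset N) x → lookup V x ≡ false → ∣ V ∪ ⁅ x ⁆ ∣ ≡ suc ∣ V ∣
  ∣∪⁅⁆∣ (false ∷ V) zero e rewrite SubsetP.∪-identityʳ V = refl
  ∣∪⁅⁆∣ (b ∷ V) (suc x) e rewrite ∨-identityʳ b | ∣∷∣ b (V ∪ ⁅ x ⁆) | ∣∷∣ b V with b
  ... | true  = cong suc (∣∪⁅⁆∣ V x e)
  ... | false = ∣∪⁅⁆∣ V x e

  ∣∣≤ : ∀ {N} (V : Subset N) → ∣ V ∣ ℕ.≤ N
  ∣∣≤ []      = ℕ.z≤n
  ∣∣≤ (b ∷ V) rewrite ∣∷∣ b V with b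
  ... | true  = ℕ.s≤s (∣∣≤ V)
  ... | false = ℕP.m≤n⇒m≤1+n (∣∣≤ V)

  Σ-members : ∀ {N} (U : Subset N) k → sumFin N (λ c → ind (lookup U c) k) ≡ ι ∣ U ∣ * k
  Σ-members []      k = sym (trans (cong (_* k) ι-0) (*-zeroˡ k))
  Σ-members (b ∷ U) k rewrite Σ-members U k | ∣∷∣ b U with b
  ... | true  = trans (cong (_+ ι ∣ U ∣ * k) (sym (*-identityˡ k)))
                  (trans (sym (*-distribʳ-+ k 1ℚ (ι ∣ U ∣)))
                    (cong (_* k) (trans (cong (_+ ι ∣ U ∣) (sym ι-1)) (sym (ι-+ 1 ∣ U ∣)))))
  ... | false = +-identityˡ _

  Σ-nonmembers : ∀ {N} (U : Subset N) k → sumFin N (λ c → ind (not (lookup U c)) k) ≡ ι (N ∸ ∣ U ∣) * k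
  Σ-nonmembers []              k = sym (trans (cong (_* k) ι-0) (*-zeroˡ k))
  Σ-nonmembers {suc N} (b ∷ U) k rewrite Σ-nonmembers U k | ∣∷∣ b U with b
  ... | false = trans (cong (_+ ι (N ∸ ∣ U ∣) * k) (sym (*-identityˡ k)))
                  (trans (sym (*-distribʳ-+ k 1ℚ (ι (N ∸ ∣ U ∣))))
                    (cong (_* k) (trans (trans (cong (_+ ι (N ∸ ∣ U ∣)) (sym ι-1)) (sym (ι-+ 1 (N ∸ ∣ U ∣))))
                      (cong ι (sym (ℕP.+-∸-assoc 1 (∣∣≤ U)))))))
  ... | true  = +-identityˡ _

  allMembers : ∀ {N} → (Fin N → Bool) → Subset N → Bool
  allMembers P []      = true
  allMembers P (b ∷ T) = (not b ∨ P zero) ∧ allMembers (λ i → P (suc i)) T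

  private
    filter-tabulate-suc : ∀ {M N} b (T : Subset N) (g : Fin M → Fin N) →
      filterᵇ (lookup (b ∷ T)) (tabulate (λ i → suc (g i))) ≡ map suc (filterᵇ (lookup T) (tabulate g))
    filter-tabulate-suc {zero}  b T g = refl
    filter-tabulate-suc {suc M} b T g with lookup T (g zero)
    ... | true  = cong (suc (g zero) ∷_) (filter-tabulate-suc b T (λ i → g (suc i)))
    ... | false = filter-tabulate-suc b T (λ i → g (suc i))

    elems-∷ : ∀ {N} b (T : Subset N) →
      elems (b ∷ T) ≡ (if b then zero ∷ map suc (elems T) else map suc (elems T))
    elems-∷ true  T = cong (zero ∷_) (filter-tabulate-suc true T (λ i → i))
    elems-∷ false T = filter-tabulate-suc false T (λ i → i)

    all-map-suc : ∀ {N} (P : Fin (suc N) → Bool) xs → all P (map suc xs) ≡ all (λ i → P (suc i)) xs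
    all-map-suc P []       = refl
    all-map-suc P (x ∷ xs) = cong (P (suc x) ∧_) (all-map-suc P xs)

  all-elems : ∀ {N} (P : Fin N → Bool) T → all P (elems T) ≡ allMembers P T
  all-elems P []         = refl
  all-elems P (true ∷ T) = trans (cong (all P) (elems-∷ true T)) (head-case (P zero))
    where
    head-case : ∀ b → (b ∧ all P (map suc (elems T))) ≡ ((not true ∨ b) ∧ allMembers (λ i → P (suc i)) T)
    head-case true  = trans (all-map-suc P (elems T)) (all-elems (λ i → P (suc i)) T)
    head-case false = refl
  all-elems P (false ∷ T) =
    trans (cong (all P) (elems-∷ false T)) (trans (all-map-suc P (elems T)) (all-elems (λ i → P (suc i)) T))

  included : ∀ {N} → Subset N → Subset N → Bool
  included []      []      = true
  included (a ∷ X) (b ∷ Y) = (not a ∨ b) ∧ included X Y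

  ⊆ᵇ≡included : ∀ {N} (X Y : Subset N) → (X ⊆ᵇ Y) ≡ included X Y
  ⊆ᵇ≡included X Y = trans (all-elems (lookup Y) X) (pointwise X Y)
    where
    pointwise : ∀ {N} (X Y : Subset N) → allMembers (lookup Y) X ≡ included X Y
    pointwise []      []      = refl
    pointwise (a ∷ X) (b ∷ Y) = cong ((not a ∨ b) ∧_) (pointwise X Y)

  included-refl : ∀ {N} (X : Subset N) → included X X ≡ true
  included-refl []          = refl
  included-refl (true ∷ X)  = included-refl X
  included-refl (false ∷ X) = included-refl X

  included-antisym : ∀ {N} (X Y : Subset N) → included X Y ≡ true → included Y X ≡ true → X ≡ Y
  included-antisym []          []          e f = refl
  included-antisym (true ∷ X)  (true ∷ Y)  e f = cong (true ∷_) (included-antisym X Y e f)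
  included-antisym (false ∷ X) (false ∷ Y) e f = cong (false ∷_) (included-antisym X Y e f)
  included-antisym (true ∷ X)  (false ∷ Y) () f
  included-antisym (false ∷ X) (true ∷ Y)  e ()

  eqSubset≡ : ∀ {N} (X Y : Subset N) → eqSubset X Y ≡ (included X Y ∧ included Y X)
  eqSubset≡ X Y = cong₂ _∧_ (⊆ᵇ≡included X Y) (⊆ᵇ≡included Y X)

  eqSubset-sound : ∀ {N} (X Y : Subset N) → eqSubset X Y ≡ true → X ≡ Y
  eqSubset-sound X Y e with trans (sym (eqSubset≡ X Y)) e
  ... | both = included-antisym X Y (∧-true-l both) (∧-true-r {included X Y} both)

  eqSubset-refl : ∀ {N} (X : Subset N) → eqSubset X X ≡ true
  eqSubset-refl X rewrite eqSubset≡ X X | included-refl X = refl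

  eqSubset-∷ : ∀ {N} a b (X Y : Subset N) → eqSubset (a ∷ X) (b ∷ Y) ≡ ((if a then b else not b) ∧ eqSubset X Y)
  eqSubset-∷ a b X Y =
    trans (eqSubset≡ (a ∷ X) (b ∷ Y))
      (trans (heads a b (included X Y) (included Y X)) (cong ((if a then b else not b) ∧_) (sym (eqSubset≡ X Y))))
    where
    heads : ∀ a b p q → (((not a ∨ b) ∧ p) ∧ ((not b ∨ a) ∧ q)) ≡ ((if a then b else not b) ∧ (p ∧ q))
    heads true  true  p q = refl
    heads true  false p q = refl
    heads false true  p q = ∧-false p
    heads false false p q = refl

  Σ-subsets-suc : ∀ N (F : Subset (suc N) → ℚ) →
    Σ (allSubsets (suc N)) F ≡ Σ (allSubsets N) (λ H → F (true ∷ H)) + Σ (allSubsets N) (λ H → F (false ∷ H))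
  Σ-subsets-suc N F =
    trans (Σ-++ (map (true ∷_) (allSubsets N)) _ F)
      (cong₂ _+_ (Σ-map (true ∷_) (allSubsets N) F)
        (trans (Σ-++ (map (false ∷_) (allSubsets N)) [] F)
          (trans (+-identityʳ _) (Σ-map (false ∷_) (allSubsets N) F))))

  Σ-subsets-at : ∀ N (U : Subset N) (g : Subset N → ℚ) → Σ (allSubsets N) (λ H → ind (eqSubset H U) (g H)) ≡ g U
  Σ-subsets-at zero    []      g = +-identityʳ (g [])
  Σ-subsets-at (suc N) (b ∷ U) g =
    trans (Σ-subsets-suc N _)
      (trans (cong₂ _+_ (Σ-cong (allSubsets N) (λ H → trans (cong (λ u → ind u (g (true ∷ H))) (eqSubset-∷ true b H U))
                                                           (ind-∧ b (eqSubset H U) _)))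
                        (Σ-cong (allSubsets N) (λ H → trans (cong (λ u → ind u (g (false ∷ H))) (eqSubset-∷ false b H U))
                                                           (ind-∧ (not b) (eqSubset H U) _))))
        (by-head b))
    where
    by-head : ∀ b → Σ (allSubsets N) (λ H → ind b (ind (eqSubset H U) (g (true ∷ H))))
                  + Σ (allSubsets N) (λ H → ind (not b) (ind (eqSubset H U) (g (false ∷ H)))) ≡ g (b ∷ U)
    by-head true  = trans (cong₂ _+_ (Σ-subsets-at N U (λ H → g (true ∷ H))) (Σ-zero (allSubsets N))) (+-identityʳ _)
    by-head false = trans (cong₂ _+_ (Σ-zero (allSubsets N)) (Σ-subsets-at N U (λ H → g (false ∷ H)))) (+-identityˡ _)

  any-++ : ∀ {A : Set} (p : A → Bool) xs ys → any p (xs ++ ys) ≡ (any p xs ∨ any p ys)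
  any-++ p []       ys = refl
  any-++ p (x ∷ xs) ys with p x
  ... | true  = refl
  ... | false = any-++ p xs ys

  any-∨ : ∀ {A : Set} (p q : A → Bool) xs → any (λ y → p y ∨ q y) xs ≡ (any p xs ∨ any q xs)
  any-∨ p q []       = refl
  any-∨ p q (x ∷ xs) with p x | q x
  ... | true  | _     = refl
  ... | false | true  = sym (∨-zeroʳ (any p xs))
  ... | false | false = any-∨ p q xs

  any-cong : ∀ {A : Set} {p q : A → Bool} xs → (∀ x → p x ≡ q x) → any p xs ≡ any q xs
  any-cong []       e = refl
  any-cong (x ∷ xs) e = cong₂ _∨_ (e x) (any-cong xs e)

  any-false : ∀ {A : Set} (xs : List A) → any (λ _ → false) xs ≡ false
  any-false []       = refl
  any-false (x ∷ xs) = any-false xs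

  distinct-++ : ∀ {N} (as bs : List (Fin N)) →
    distinct (as ++ bs) ≡ (distinct as ∧ (distinct bs ∧ not (any (λ y → any (y ==F_) as) bs)))
  distinct-++ [] bs =
    trans (sym (∧-identityʳ _)) (cong (λ u → distinct bs ∧ not u) (sym (any-false bs)))
  distinct-++ (x ∷ as) bs =
    trans (cong₂ (λ u v → not u ∧ v) (any-++ (x ==F_) as bs) (distinct-++ as bs))
      (trans (regroup (any (x ==F_) as) (any (x ==F_) bs) (distinct as) (distinct bs) (any (λ y → any (y ==F_) as) bs))
        (cong (λ u → (not (any (x ==F_) as) ∧ distinct as) ∧ (distinct bs ∧ not u))
          (trans (cong (_∨ any (λ y → any (y ==F_) as) bs) (any-cong bs (λ y → ==F-sym x y)))
            (sym (any-∨ (λ y → y ==F x) (λ y → any (y ==F_) as) bs)))))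
    where
    regroup : ∀ a b c d e → (not (a ∨ b) ∧ (c ∧ (d ∧ not e))) ≡ ((not a ∧ c) ∧ (d ∧ not (b ∨ e)))
    regroup true  b     c     d e = refl
    regroup false true  c     d e = sym (trans (cong (c ∧_) (∧-false d)) (∧-false c))
    regroup false false true  d e = refl
    regroup false false false d e = refl

  distinct-snoc : ∀ {N} (as : List (Fin N)) c → distinct (as ++ c ∷ []) ≡ (distinct as ∧ not (any (c ==F_) as))
  distinct-snoc as c =
    trans (distinct-++ as (c ∷ []))
      (cong (λ u → distinct as ∧ not u) (∨-identityʳ (any (c ==F_) as)))

  remove-∪-⁅⁆-new : ∀ {N} (V : Subset N) c → lookup V c ≡ false → remove (V ∪ ⁅ c ⁆) c ≡ V
  remove-∪-⁅⁆-new V c vc = subset-ext _ _ pointwise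
    where
    pointwise : ∀ i → lookup (remove (V ∪ ⁅ c ⁆) c) i ≡ lookup V i
    pointwise i rewrite lookup-remove (V ∪ ⁅ c ⁆) c i | lookup-∪ V ⁅ c ⁆ i | lookup-⁅⁆ c i with i ==F c in e
    ... | true with ==F⇒≡ i c e
    ...   | refl = sym vc
    pointwise i | false = ∨-identityʳ _

  add-new-element : ∀ {N} (V U : Subset N) c →
    (not (lookup V c) ∧ eqSubset (V ∪ ⁅ c ⁆) U) ≡ (lookup U c ∧ eqSubset V (remove U c))
  add-new-element V U c = bool-ext forward backward
    where
    forward : (not (lookup V c) ∧ eqSubset (V ∪ ⁅ c ⁆) U) ≡ true → (lookup U c ∧ eqSubset V (remove U c)) ≡ true
    forward e = ∧-true (subst (λ Z → lookup Z c ≡ true) V∪c≡U c-added)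
                       (subst (λ Z → eqSubset V (remove Z c) ≡ true) V∪c≡U
                         (subst (λ Z → eqSubset V Z ≡ true) (sym (remove-∪-⁅⁆-new V c vc)) (eqSubset-refl V)))
      where
      vc : lookup V c ≡ false
      vc = not-true (∧-true-l e)
      V∪c≡U : V ∪ ⁅ c ⁆ ≡ U
      V∪c≡U = eqSubset-sound _ U (∧-true-r {not (lookup V c)} e)
      c-added : lookup (V ∪ ⁅ c ⁆) c ≡ true
      c-added = trans (lookup-∪ V ⁅ c ⁆ c) (trans (cong (lookup V c ∨_) (trans (lookup-⁅⁆ c c) (==F-refl c)))
                  (∨-zeroʳ (lookup V c)))
    backward : (lookup U c ∧ eqSubset V (remove U c)) ≡ true → (not (lookup V c) ∧ eqSubset (V ∪ ⁅ c ⁆) U) ≡ true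
    backward e = ∧-true (subst (λ Z → not (lookup Z c) ≡ true) (sym V≡U-c) c-removed)
                        (subst (λ Z → eqSubset (Z ∪ ⁅ c ⁆) U ≡ true) (sym V≡U-c)
                          (subst (λ Z → eqSubset Z U ≡ true) (sym (remove-∪-⁅⁆ U c (∧-true-l e))) (eqSubset-refl U)))
      where
      V≡U-c : V ≡ remove U c
      V≡U-c = eqSubset-sound V _ (∧-true-r {lookup U c} e)
      c-removed : not (lookup (remove U c) c) ≡ true
      c-removed = not-false (trans (lookup-remove U c c) (cong (λ u → not u ∧ lookup U c) (==F-refl c)))

  ∪-fromList-snoc : ∀ {N} (H : Subset N) as c → H ∪ fromList (as ++ c ∷ []) ≡ (H ∪ fromList as) ∪ ⁅ c ⁆
  ∪-fromList-snoc H as c = subset-ext _ _ λ i →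
    trans (lookup-∪-fromList H (as ++ c ∷ []) i)
      (trans (cong (lookup H i ∨_) (trans (any-++ (i ==F_) as (c ∷ [])) (cong (any (i ==F_) as ∨_) (∨-identityʳ (i ==F c)))))
        (trans (sym (∨-assoc (lookup H i) _ _))
          (sym (trans (lookup-∪ (H ∪ fromList as) ⁅ c ⁆ i)
                 (cong₂ _∨_ (lookup-∪-fromList H as i) (lookup-⁅⁆ c i))))))

  pathTo : ∀ {N} → ℕ → ℕ → Subset N → Subset N → List (Fin N) → Bool
  pathTo h ℓ U H as =
    (length as ℕ.≡ᵇ ℓ) ∧ ((∣ H ∣ ℕ.≡ᵇ h) ∧ ((distinct as ∧ not (any (lookup H) as)) ∧ eqSubset (H ∪ fromList as) U))

  pathTo-length : ∀ {N} h ℓ (U H : Subset N) as → pathTo h ℓ U H as ≡ true → length as ≡ ℓ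
  pathTo-length h ℓ U H as e = ℕP.≡ᵇ⇒≡ (length as) ℓ (≡true⇒T (∧-true-l e))

  pathTo-end : ∀ {N} h ℓ (U H : Subset N) as → pathTo h ℓ U H as ≡ true → H ∪ fromList as ≡ U
  pathTo-end h ℓ U H as e =
    eqSubset-sound _ _ (∧-true-r {distinct as ∧ _} (∧-true-r {∣ H ∣ ℕ.≡ᵇ h} (∧-true-r {length as ℕ.≡ᵇ ℓ} e)))

  length-snoc-test : ∀ {A : Set} (as : List A) c ℓ → (length (as ++ c ∷ []) ℕ.≡ᵇ suc ℓ) ≡ (length as ℕ.≡ᵇ ℓ)
  length-snoc-test as c ℓ rewrite ListP.length-++ as {c ∷ []} | ℕP.+-comm (length as) 1 = refl

  pathTo-snoc : ∀ {N} h ℓ (U H : Subset N) as c →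
    pathTo h (suc ℓ) U H (as ++ c ∷ []) ≡ (lookup U c ∧ pathTo h ℓ (remove U c) H as)
  pathTo-snoc h ℓ U H as c
    rewrite length-snoc-test as c ℓ | distinct-snoc as c | any-++ (lookup H) as (c ∷ []) | ∪-fromList-snoc H as c =
    trans (regroup L hH (distinct as) (any (c ==F_) as) (any (lookup H) as) (lookup H c) (eqSubset ((H ∪ fromList as) ∪ ⁅ c ⁆) U))
      (trans (cong (λ u → L ∧ (hH ∧ (D ∧ (not u ∧ eqSubset ((H ∪ fromList as) ∪ ⁅ c ⁆) U)))) (sym (lookup-∪-fromList H as c)))
        (trans (cong (λ u → L ∧ (hH ∧ (D ∧ u))) (add-new-element (H ∪ fromList as) U c))
          (pull-out L hH D (lookup U c) _)))
    where
    L hH D : Bool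
    L = length as ℕ.≡ᵇ ℓ
    hH = ∣ H ∣ ℕ.≡ᵇ h
    D = distinct as ∧ not (any (lookup H) as)
    regroup : ∀ L hH dA NC hA HC E → (L ∧ (hH ∧ (((dA ∧ not NC) ∧ not (hA ∨ (HC ∨ false))) ∧ E)))
              ≡ (L ∧ (hH ∧ ((dA ∧ not hA) ∧ (not (HC ∨ NC) ∧ E))))
    regroup L hH false NC    hA    HC    E = refl
    regroup L hH true  true  true  HC    E = refl
    regroup L hH true  true  false true  E = refl
    regroup L hH true  true  false false E = refl
    regroup L hH true  false true  HC    E = refl
    regroup L hH true  false false true  E = refl
    regroup L hH true  false false false E = refl
    pull-out : ∀ L hH X Uc E → (L ∧ (hH ∧ (X ∧ (Uc ∧ E)))) ≡ (Uc ∧ (L ∧ (hH ∧ (X ∧ E))))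
    pull-out L     hH    X     true  E = refl
    pull-out false hH    X     false E = refl
    pull-out true  false X     false E = refl
    pull-out true  true  false false E = refl
    pull-out true  true  true  false E = refl

  pathSum : ∀ {N} → ℕ → ℕ → Subset N → (Subset N → List (Fin N) → ℚ) → ℚ
  pathSum {N} h ℓ U f = Σ (allSubsets N) (λ H → Σ (allLists (allFin N) ℓ) (λ as → ind (pathTo h ℓ U H as) (f H as)))

  pathSum-cong : ∀ {N} h ℓ (U : Subset N) f g → (∀ H as → pathTo h ℓ U H as ≡ true → f H as ≡ g H as) →
    pathSum h ℓ U f ≡ pathSum h ℓ U g
  pathSum-cong {N} h ℓ U f g e =
    Σ-cong (allSubsets N) (λ H → Σ-cong (allLists (allFin N) ℓ) (λ as → ind-congᵇ (e H as)))

  pathSum-*ʳ : ∀ {N} h ℓ (U : Subset N) f k → pathSum h ℓ U (λ H as → f H as * k) ≡ pathSum h ℓ U f * k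
  pathSum-*ʳ {N} h ℓ U f k =
    trans (Σ-cong (allSubsets N) (λ H →
            trans (Σ-cong (allLists (allFin N) ℓ) (λ as → ind-*ʳ (pathTo h ℓ U H as) (f H as) k))
                  (Σ-*ʳ (allLists (allFin N) ℓ) k _)))
      (Σ-*ʳ (allSubsets N) k _)

  -- the only path of length 0 to a set U of size h is (U , [])
  pathSum-zero : ∀ {N} h (U : Subset N) f → ∣ U ∣ ≡ h → pathSum h 0 U f ≡ f U []
  pathSum-zero {N} h U f ∣U∣≡h =
    trans (Σ-cong (allSubsets N) (λ H → trans (+-identityʳ _) (cong (λ b → ind b (f H [])) (start H))))
      (Σ-subsets-at N U (λ H → f H []))
    where
    start : ∀ H → pathTo h 0 U H [] ≡ eqSubset H U
    start H rewrite SubsetP.∪-identityʳ H = bool-ext (∧-true-r {∣ H ∣ ℕ.≡ᵇ h}) λ e →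
      ∧-true (subst (λ Z → (∣ Z ∣ ℕ.≡ᵇ h) ≡ true) (sym (eqSubset-sound H U e))
               (subst (λ k → (k ℕ.≡ᵇ h) ≡ true) (sym ∣U∣≡h) (≡ᵇ-refl h))) e

  pathSum-suc : ∀ {N} h ℓ (U : Subset N) f →
    pathSum h (suc ℓ) U f ≡ sumFin N (λ c → ind (lookup U c) (pathSum h ℓ (remove U c) (λ H as → f H (as ++ c ∷ []))))
  pathSum-suc {N} h ℓ U f =
    trans (Σ-cong (allSubsets N) (λ H →
            trans (Σ-words-snoc (allFin N) ℓ _)
              (trans (Σ-cong (allLists (allFin N) ℓ) (λ as → Σ-cong (allFin N) (λ c →
                        trans (cong (λ b → ind b (f H (as ++ c ∷ []))) (pathTo-snoc h ℓ U H as c))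
                              (ind-∧ (lookup U c) _ _))))
                (Σ-swap (allLists (allFin N) ℓ) (allFin N) _))))
      (trans (Σ-swap (allSubsets N) (allFin N) _)
        (trans (Σ-allFin N _)
          (sumFin-cong N (λ c → trans (Σ-cong (allSubsets N) (λ H → Σ-ind (allLists (allFin N) ℓ) (lookup U c) _))
                                       (Σ-ind (allSubsets N) (lookup U c) _)))))

  ∣remove∣≡ : ∀ {N} h ℓ (U : Subset N) c → ∣ U ∣ ≡ h ℕ.+ suc ℓ → lookup U c ≡ true → ∣ remove U c ∣ ≡ h ℕ.+ ℓ
  ∣remove∣≡ h ℓ U c ∣U∣ c∈U = ℕP.suc-injective (trans (∣remove∣ U c c∈U) (trans ∣U∣ (ℕP.+-suc h ℓ)))

  rejectAll-snoc : ∀ {N} n m k (T : Subset N) as c →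
    rejectAll n m k T (as ++ c ∷ []) ≡ rejectAll n m k T as * rejectProb n m (k ℕ.+ length as) (T ∪ fromList as) c
  rejectAll-snoc n m k T [] c rewrite ℕP.+-identityʳ k | SubsetP.∪-identityʳ T =
    trans (*-identityʳ (rejectProb n m k T c)) (sym (*-identityˡ (rejectProb n m k T c)))
  rejectAll-snoc n m k T (a ∷ as) c
    rewrite rejectAll-snoc n m (suc k) (T ∪ ⁅ a ⁆) as c | ℕP.+-suc k (length as) | SubsetP.∪-assoc T ⁅ a ⁆ (fromList as) =
    sym (*-assoc (rejectProb n m k T a) _ _)

  -- the number of paths to a set of size h + ℓ:  (h+1)(h+2)⋯(h+ℓ)
  arrangements : ℕ → ℕ → ℕ
  arrangements h zero    = 1
  arrangements h (suc ℓ) = (h ℕ.+ suc ℓ) ℕ.* arrangements h ℓ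

  -- there is at least one path, so the conditional probability is well defined
  arrangements-pos : ∀ h ℓ → 1 ℕ.≤ arrangements h ℓ
  arrangements-pos h zero    = ℕP.≤-refl
  arrangements-pos h (suc ℓ) =
    ℕP.*-mono-≤ {1} {h ℕ.+ suc ℓ} {1} (ℕP.≤-trans (ℕ.s≤s ℕ.z≤n) (ℕP.m≤n+m (suc ℓ) h)) (arrangements-pos h ℓ)

  pathCount : ∀ {N} h ℓ (U : Subset N) → ∣ U ∣ ≡ h ℕ.+ ℓ → pathSum h ℓ U (λ _ _ → 1ℚ) ≡ ι (arrangements h ℓ)
  pathCount h zero U ∣U∣ = trans (pathSum-zero h U (λ _ _ → 1ℚ) (trans ∣U∣ (ℕP.+-identityʳ h))) (sym ι-1)
  pathCount {N} h (suc ℓ) U ∣U∣ =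
    trans (pathSum-suc h ℓ U _)
      (trans (sumFin-restrict (lookup U) _ (λ _ → ι (arrangements h ℓ))
               (λ c c∈U → pathCount h ℓ (remove U c) (∣remove∣≡ h ℓ U c ∣U∣ c∈U)))
        (trans (Σ-members U (ι (arrangements h ℓ)))
          (trans (cong (λ z → ι z * ι (arrangements h ℓ)) ∣U∣) (sym (ι-* (h ℕ.+ suc ℓ) (arrangements h ℓ))))))

  module RejectionPathSum (n m h : ℕ) {N : ℕ} (R : ℕ → ℚ)
    (R-is-round-sum : ∀ k (U : Subset N) → ∣ U ∣ ≡ h ℕ.+ k →
       sumFin N (λ c → ind (lookup U c) (rejectProb n m k (remove U c) c)) ≡ R k) where

    prodR : ℕ → ℚ
    prodR zero    = 1ℚ
    prodR (suc ℓ) = prodR ℓ * R (suc ℓ)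

    rejectionPathSum : ∀ ℓ (U : Subset N) → ∣ U ∣ ≡ h ℕ.+ ℓ → pathSum h ℓ U (rejectAll n m 1) ≡ prodR ℓ
    rejectionPathSum zero U ∣U∣ = pathSum-zero h U (rejectAll n m 1) (trans ∣U∣ (ℕP.+-identityʳ h))
    rejectionPathSum (suc ℓ) U ∣U∣ =
      trans (pathSum-suc h ℓ U _)
        (trans (sumFin-restrict (lookup U) _ (λ c → prodR ℓ * rejectProb n m (suc ℓ) (remove U c) c) last-round)
          (trans (sumFin-cong N (λ c → ind-*ˡ (lookup U c) (prodR ℓ) _))
            (trans (sumFin-*ˡ N (prodR ℓ) _) (cong (prodR ℓ *_) (R-is-round-sum (suc ℓ) U ∣U∣)))))
      where
      last-round : ∀ c → lookup U c ≡ true →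
        pathSum h ℓ (remove U c) (λ H as → rejectAll n m 1 H (as ++ c ∷ [])) ≡ prodR ℓ * rejectProb n m (suc ℓ) (remove U c) c
      last-round c c∈U =
        trans (pathSum-cong h ℓ (remove U c) _ (λ H as → rejectAll n m 1 H as * rejectProb n m (suc ℓ) (remove U c) c)
                (λ H as p → trans (rejectAll-snoc n m 1 H as c)
                  (cong₂ (λ k Z → rejectAll n m 1 H as * rejectProb n m k Z c)
                         (cong suc (pathTo-length h ℓ (remove U c) H as p)) (pathTo-end h ℓ (remove U c) H as p))))
          (trans (pathSum-*ʳ h ℓ (remove U c) (rejectAll n m 1) _)
            (cong (_* rejectProb n m (suc ℓ) (remove U c) c) (rejectionPathSum ℓ (remove U c) (∣remove∣≡ h ℓ U c ∣U∣ c∈U))))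

  choose : ℕ → ℕ → ℕ
  choose n       zero    = 1
  choose zero    (suc k) = 0
  choose (suc n) (suc k) = choose n k ℕ.+ choose n (suc k)

  choose-pos : ∀ s k → k ℕ.≤ s → 1 ℕ.≤ choose s k
  choose-pos s       zero    _           = ℕ.s≤s ℕ.z≤n
  choose-pos (suc s) (suc k) (ℕ.s≤s le) = ℕP.≤-trans (choose-pos s k le) (ℕP.m≤m+n (choose s k) _)

  choose-absorb : ∀ s k → suc k ℕ.* choose (suc s) (suc k) ≡ suc s ℕ.* choose s k
  choose-absorb zero    zero    = refl
  choose-absorb zero    (suc k) rewrite ℕP.*-zeroʳ k = refl
  choose-absorb (suc s) k =
    begin
      suc k ℕ.* (choose (suc s) k ℕ.+ choose (suc s) (suc k))
    ≡⟨ ℕP.*-distribˡ-+ (suc k) (choose (suc s) k) _ ⟩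
      suc k ℕ.* choose (suc s) k ℕ.+ suc k ℕ.* choose (suc s) (suc k)
    ≡⟨ cong (suc k ℕ.* choose (suc s) k ℕ.+_) (choose-absorb s k) ⟩
      choose (suc s) k ℕ.+ k ℕ.* choose (suc s) k ℕ.+ suc s ℕ.* choose s k
    ≡⟨ ℕP.+-assoc (choose (suc s) k) _ _ ⟩
      choose (suc s) k ℕ.+ (k ℕ.* choose (suc s) k ℕ.+ suc s ℕ.* choose s k)
    ≡⟨ cong (choose (suc s) k ℕ.+_) (lower k) ⟩
      choose (suc s) k ℕ.+ suc s ℕ.* choose (suc s) k
    ∎
    where
    open ≡-Reasoning
    lower : ∀ k → k ℕ.* choose (suc s) k ℕ.+ suc s ℕ.* choose s k ≡ suc s ℕ.* choose (suc s) k
    lower zero     = refl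
    lower (suc k') = trans (cong (ℕ._+ suc s ℕ.* choose s (suc k')) (choose-absorb s k'))
                       (sym (ℕP.*-distribˡ-+ (suc s) (choose s k') (choose s (suc k'))))

  -- The j-subsets X ⊆ T, each weighted by a test w X: with w = true this counts
  -- C(|T|, j); with w X = "every member of X lies below c" it counts the draws
  -- X_k on which round k accepts c.
  subsetSum : ∀ {N} → ℕ → Subset N → (Subset N → Bool) → ℚ
  subsetSum {N} j T w = Σ (allSubsets N) (λ X → ind (included X T ∧ (∣ X ∣ ℕ.≡ᵇ j)) (ind (w X) 1ℚ))

  subsetSum⁻ : ∀ {N} → ℕ → Subset N → (Subset N → Bool) → ℚ
  subsetSum⁻ zero    T w = 0ℚ
  subsetSum⁻ (suc j) T w = subsetSum j T w

  subsetSum-∷ : ∀ {N} j b (T : Subset N) (w : Subset (suc N) → Bool) →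
    subsetSum j (b ∷ T) w ≡ ind b (subsetSum⁻ j T (λ X → w (true ∷ X))) + subsetSum j T (λ X → w (false ∷ X))
  subsetSum-∷ {N} j b T w = trans (Σ-subsets-suc N _) (cong (_+ subsetSum j T (λ X → w (false ∷ X))) (first-in j b))
    where
    first-in : ∀ j b → Σ (allSubsets N) (λ X → ind ((b ∧ included X T) ∧ (suc ∣ X ∣ ℕ.≡ᵇ j)) (ind (w (true ∷ X)) 1ℚ))
                     ≡ ind b (subsetSum⁻ j T (λ X → w (true ∷ X)))
    first-in j       false = Σ-zero (allSubsets N)
    first-in zero    true  = trans (Σ-cong (allSubsets N) (λ X → cong (λ u → ind u _) (∧-false (included X T))))
                                   (Σ-zero (allSubsets N))
    first-in (suc j) true  = refl

  countSubsets : ∀ {N} j (T : Subset N) → subsetSum j T (λ _ → true) ≡ ι (choose ∣ T ∣ j)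
  countSubsets zero    []      = trans (+-identityʳ 1ℚ) (sym ι-1)
  countSubsets (suc j) []      = trans (+-identityʳ 0ℚ) (sym ι-0)
  countSubsets j       (b ∷ T) = trans (subsetSum-∷ j b T (λ _ → true)) (by-head b j)
    where
    by-head : ∀ b j → ind b (subsetSum⁻ j T (λ _ → true)) + subsetSum j T (λ _ → true) ≡ ι (choose ∣ b ∷ T ∣ j)
    by-head false j       = trans (+-identityˡ _) (countSubsets j T)
    by-head true  zero    = trans (+-identityˡ _) (countSubsets zero T)
    by-head true  (suc j) = trans (cong₂ _+_ (countSubsets j T) (countSubsets (suc j) T))
                              (sym (ι-+ (choose ∣ T ∣ j) _))

  countBelow : ∀ {N} → ℕ → Subset N → Fin N → ℚ
  countBelow j T c = subsetSum j T (allMembers (λ x → x <F c))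

  allMembers-false : ∀ {N} (X : Subset N) → allMembers (λ _ → false) X ≡ (∣ X ∣ ℕ.≡ᵇ 0)
  allMembers-false []          = refl
  allMembers-false (true ∷ X)  = refl
  allMembers-false (false ∷ X) = allMembers-false X

  -- nothing lies below the least point, so only the empty set counts
  countBelow-zero : ∀ {N} j (U : Subset N) → countBelow j (false ∷ U) zero ≡ ind (j ℕ.≡ᵇ 0) 1ℚ
  countBelow-zero {N} j U =
    trans (subsetSum-∷ j false U _)
      (trans (+-identityˡ _)
        (trans (Σ-cong (allSubsets N) (λ X → cong (λ u → ind (included X U ∧ (∣ X ∣ ℕ.≡ᵇ j)) (ind u 1ℚ)) (allMembers-false X)))
          (only-empty j)))
    where
    only-empty : ∀ j → subsetSum j U (λ X → ∣ X ∣ ℕ.≡ᵇ 0) ≡ ind (j ℕ.≡ᵇ 0) 1ℚ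
    only-empty zero    = trans (Σ-cong (allSubsets N) (λ X → size-zero (included X U) ∣ X ∣)) (trans (countSubsets 0 U) ι-1)
      where
      size-zero : ∀ a x → ind (a ∧ (x ℕ.≡ᵇ 0)) (ind (x ℕ.≡ᵇ 0) 1ℚ) ≡ ind (a ∧ (x ℕ.≡ᵇ 0)) (ind true 1ℚ)
      size-zero a zero    = refl
      size-zero a (suc x) = trans (cong (λ u → ind u _) (∧-false a)) (cong (λ u → ind u _) (sym (∧-false a)))
    only-empty (suc j) = trans (Σ-cong (allSubsets N) (λ X → size-suc (included X U) ∣ X ∣)) (Σ-zero (allSubsets N))
      where
      size-suc : ∀ a x → ind (a ∧ (x ℕ.≡ᵇ suc j)) (ind (x ℕ.≡ᵇ 0) 1ℚ) ≡ 0ℚ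
      size-suc a zero    = cong (λ u → ind u _) (∧-false a)
      size-suc a (suc x) = ind-0 _

  -- Every (j+1)-subset of U is counted once, at its maximum c, as the j-subset
  -- of U ∖ {c} below c:  Σ_{c ∈ U} countBelow j (U ∖ {c}) c = C(|U|, j+1).
  countBelow-sum : ∀ N j (U : Subset N) →
    sumFin N (λ c → ind (lookup U c) (countBelow j (remove U c) c)) ≡ ι (choose ∣ U ∣ (suc j))
  countBelow-sum zero    j []      = sym ι-0
  countBelow-sum (suc N) j (b ∷ U) =
    trans (cong₂ _+_ (cong (ind b) (countBelow-zero j U))
            (trans (sumFin-cong N (λ c → trans (cong (ind (lookup U c)) (subsetSum-∷ j b (remove U c) _))
                                         (trans (ind-+ (lookup U c) _ _) (cong (_+ _) (ind-swap (lookup U c) b)))))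
              (trans (sumFin-+ N _ _) (cong (_+ _) (sumFin-ind b)))))
      (by-head b j)
    where
    ind-swap : ∀ a b {x} → ind a (ind b x) ≡ ind b (ind a x)
    ind-swap a true  = refl
    ind-swap a false = ind-0 a
    sumFin-ind : ∀ b {f : Fin N → ℚ} → sumFin N (λ c → ind b (f c)) ≡ ind b (sumFin N f)
    sumFin-ind true  = refl
    sumFin-ind false = sumFin-zero N
    lower : ℕ → ℚ
    lower j = sumFin N (λ c → ind (lookup U c) (subsetSum⁻ j (remove U c) (allMembers (λ x → x <F c))))
    lower-zero : lower zero ≡ 0ℚ
    lower-zero = trans (sumFin-cong N (λ c → ind-0 (lookup U c))) (sumFin-zero N)
    by-head : ∀ b j → ind b (ind (j ℕ.≡ᵇ 0) 1ℚ) + (ind b (lower j) + sumFin N (λ c → ind (lookup U c) (countBelow j (remove U c) c)))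
                      ≡ ι (choose ∣ b ∷ U ∣ (suc j))
    by-head false j       = trans (+-identityˡ _) (trans (+-identityˡ _) (countBelow-sum N j U))
    by-head true  zero    =
      trans (cong (1ℚ +_) (trans (cong₂ _+_ lower-zero (countBelow-sum N zero U)) (+-identityˡ (ι (choose ∣ U ∣ 1)))))
        (trans (cong (_+ ι (choose ∣ U ∣ 1)) (sym ι-1)) (sym (ι-+ 1 (choose ∣ U ∣ 1))))
    by-head true  (suc j) = trans (+-identityˡ _)
                              (trans (cong₂ _+_ (countBelow-sum N j U) (countBelow-sum N (suc j) U))
                                (sym (ι-+ (choose ∣ U ∣ (suc j)) _)))

  -- Round sums.  For c ∈ U and T_{k-1} = U ∖ {c}, round k sees T_k = U, so the
  -- rejection probability depends on U, c and the draws X ⊆ U ∖ {c} only.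

  notMax-sum : ∀ N (U : Subset N) → sumFin N (λ c → ind (lookup U c) (if isMax c U then 0ℚ else 1ℚ)) ≡ ι (∣ U ∣ ∸ 1)
  notMax-sum zero    []      = sym ι-0
  notMax-sum (suc N) (b ∷ U) =
    trans (cong₂ _+_ (cong (λ u → ind b (if u then 0ℚ else 1ℚ)) max-at-zero)
            (trans (sumFin-cong N (λ c → cong (λ u → ind (lookup U c) (if u then 0ℚ else 1ℚ)) (max-at-suc c)))
              (notMax-sum N U)))
      (trans (by-head b ∣ U ∣) (cong (λ z → ι (z ∸ 1)) (sym (∣∷∣ b U))))
    where
    max-at-zero : isMax zero (b ∷ U) ≡ (∣ U ∣ ℕ.≡ᵇ 0)
    max-at-zero = trans (all-elems _ (b ∷ U)) (trans (cong (_∧ allMembers (λ _ → false) U) (∨-zeroʳ (not b)))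
                    (allMembers-false U))
    max-at-suc : ∀ c → isMax (suc c) (b ∷ U) ≡ isMax c U
    max-at-suc c = trans (all-elems _ (b ∷ U)) (trans (cong (_∧ _) (∨-zeroʳ (not b))) (sym (all-elems _ U)))
    by-head : ∀ b t → ind b (if t ℕ.≡ᵇ 0 then 0ℚ else 1ℚ) + ι (t ∸ 1) ≡ ι ((if b then suc t else t) ∸ 1)
    by-head false t       = +-identityˡ _
    by-head true  zero    = +-identityˡ _
    by-head true  (suc t) = trans (cong (_+ ι t) (sym ι-1)) (sym (ι-+ 1 t))

  -- the field identity behind the random-draw case: X·D = S, S + C = a·D and
  -- n·C = a·D give X = a(1 - 1/n)
  mean-from-complement : ∀ X a D C n r d S → X * D ≡ S → S + C ≡ a * D → n * C ≡ a * D → r * n ≡ 1ℚ → d * D ≡ 1ℚ →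
    X ≡ a * (1ℚ - r)
  mean-from-complement X a D C n r d S XD SC nC rn dD =
    begin
      X                              ≡⟨ sym (trans (cong (X *_) dD) (*-identityʳ X)) ⟩
      X * (d * D)                    ≡⟨ solve 3 (λ X d D → X :* (d :* D) := d :* (X :* D)) refl X d D ⟩
      d * (X * D)                    ≡⟨ cong (d *_) (trans XD (solve 2 (λ S C → S := (S :+ C) :- C) refl S C)) ⟩
      d * ((S + C) - C)              ≡⟨ cong (λ z → d * (z - C)) SC ⟩
      d * (a * D - C)                ≡⟨ cong (λ z → d * (a * D - z)) (sym (trans (cong (_* C) rn) (*-identityˡ C))) ⟩
      d * (a * D - (r * n) * C)      ≡⟨ cong (λ z → d * (a * D - z)) (trans (*-assoc r n C) (cong (r *_) nC)) ⟩
      d * (a * D - r * (a * D))      ≡⟨ solve 4 (λ d a D r → d :* (a :* D :- r :* (a :* D)) := (a :* (con 1ℚ :- r)) :* (d :* D)) refl d a D r ⟩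
      (a * (1ℚ - r)) * (d * D)       ≡⟨ trans (cong ((a * (1ℚ - r)) *_) dD) (*-identityʳ _) ⟩
      a * (1ℚ - r)
    ∎
    where open ≡-Reasoning

  allDraws : ∀ {N} → ℕ → Subset N → ℕ
  allDraws j T = length (subsetsOfSize j T)

  badDraws : ∀ {N} → ℕ → Subset N → Fin N → ℕ
  badDraws j T c = length (filterᵇ (λ X → not (aboveAll c X)) (subsetsOfSize j T))

  subsetsOfSize-test : ∀ {N} j (T X : Subset N) → ((X ⊆ᵇ T) ∧ (∣ X ∣ ℕ.≡ᵇ j)) ≡ (included X T ∧ (∣ X ∣ ℕ.≡ᵇ j))
  subsetsOfSize-test j T X = cong (_∧ (∣ X ∣ ℕ.≡ᵇ j)) (⊆ᵇ≡included X T)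

  allDraws-count : ∀ {N} j (T : Subset N) → ι (allDraws j T) ≡ ι (choose ∣ T ∣ j)
  allDraws-count {N} j T =
    trans (length-filter _ (allSubsets N))
      (trans (Σ-cong (allSubsets N) (λ X → cong (λ u → ind u 1ℚ) (subsetsOfSize-test j T X))) (countSubsets j T))

  -- every draw either rejects c or lies entirely below c
  bad+good-draws : ∀ {N} j (T : Subset N) c → ι (badDraws j T c) + countBelow j T c ≡ ι (choose ∣ T ∣ j)
  bad+good-draws {N} j T c =
    trans (cong (_+ countBelow j T c)
            (trans (length-filter _ (subsetsOfSize j T))
              (trans (Σ-filter (allSubsets N) _ _)
                (Σ-cong (allSubsets N) (λ X → cong₂ (λ u v → ind u (ind (not v) 1ℚ))
                                                (subsetsOfSize-test j T X) (all-elems _ X))))))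
      (trans (sym (Σ-+ (allSubsets N) _ _))
        (trans (Σ-cong (allSubsets N) (λ X → ind-not+ind (included X T ∧ (∣ X ∣ ℕ.≡ᵇ j)) (allMembers (λ x → x <F c) X)))
          (countSubsets j T)))

  draw-sum : ∀ {N} j s (U : Subset N) → ∣ U ∣ ≡ suc s → j ℕ.≤ s →
    sumFin N (λ c → ind (lookup U c) (frac (badDraws j (remove U c) c) (allDraws j (remove U c))))
      ≡ ι (suc s) * (1ℚ - frac 1 (suc j))
  draw-sum {N} j s U ∣U∣ j≤s with pos⇒suc (choose s j) (choose-pos s j j≤s)
  ... | d , D≡ =
    mean-from-complement _ (ι (suc s)) (ι D) good (ι (suc j)) (frac 1 (suc j)) (frac 1 (suc d)) bad
      (trans (sym (sumFin-*ʳ N (ι D) _))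
        (trans (sumFin-cong N (λ c → sym (ind-*ʳ (lookup U c) _ (ι D)))) (sumFin-restrict (lookup U) _ _ cancel)))
      (trans (sym (sumFin-+ N _ _))
        (trans (sumFin-cong N (λ c → sym (ind-+ (lookup U c) _ _)))
          (trans (sumFin-restrict (lookup U) _ (λ _ → ι D) (λ c c∈U → trans (bad+good-draws j (remove U c) c) (ι-D c c∈U)))
            (trans (Σ-members U (ι D)) (cong (λ z → ι z * ι D) ∣U∣)))))
      (trans (cong (ι (suc j) *_) (trans (countBelow-sum N j U) (cong (λ z → ι (choose z (suc j))) ∣U∣)))
        (trans (sym (ι-* (suc j) (choose (suc s) (suc j)))) (trans (cong ι (choose-absorb s j)) (ι-* (suc s) D))))
      (frac-inverse j)
      (trans (cong (λ z → frac 1 (suc d) * ι z) D≡) (frac-inverse d))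
    where
    D : ℕ
    D = choose s j
    bad good : ℚ
    bad = sumFin N (λ c → ind (lookup U c) (ι (badDraws j (remove U c) c)))
    good = sumFin N (λ c → ind (lookup U c) (countBelow j (remove U c) c))
    ι-D : ∀ c → lookup U c ≡ true → ι (choose ∣ remove U c ∣ j) ≡ ι D
    ι-D c c∈U = cong (λ z → ι (choose z j)) (ℕP.suc-injective (trans (∣remove∣ U c c∈U) ∣U∣))
    cancel : ∀ c → lookup U c ≡ true → frac (badDraws j (remove U c) c) (allDraws j (remove U c)) * ι D ≡ ι (badDraws j (remove U c) c)
    cancel c c∈U
      rewrite ι-injective _ _ (trans (allDraws-count j (remove U c)) (ι-D c c∈U)) | D≡ = frac-cancel _ d

  -- The round-k sum over c ∈ U of Pr[round k rejects c | T_{k-1} = U ∖ {c}]: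
  -- every c is rejected during the observation phase k ≤ m; while |U| ≤ n only the
  -- maximum is accepted; beyond that a uniformly random draw decides.
  roundValue : ℕ → ℕ → ℕ → ℕ → ℚ
  roundValue n m k s =
    if k ℕ.≤ᵇ m then ι s else (if s ℕ.≤ᵇ n then ι (s ∸ 1) else ι s * (1ℚ - frac 1 n))

  round-sum : ∀ j m k {N} (U : Subset N) →
    sumFin N (λ c → ind (lookup U c) (rejectProb (suc j) m k (remove U c) c)) ≡ roundValue (suc j) m k ∣ U ∣
  round-sum j m k {N} U =
    trans (sumFin-restrict (lookup U) _ _ (λ c c∈U →
            cong₂ (λ Z s → if k ℕ.≤ᵇ m then 1ℚ else (if s ℕ.≤ᵇ suc j then (if isMax c Z then 0ℚ else 1ℚ) else draw c))
                  (remove-∪-⁅⁆ U c c∈U) (cong ∣_∣ (remove-∪-⁅⁆ U c c∈U))))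
      by-case
    where
    draw : Fin N → ℚ
    draw c = frac (badDraws j (remove U c) c) (allDraws j (remove U c))
    by-case : sumFin N (λ c → ind (lookup U c) (if k ℕ.≤ᵇ m then 1ℚ
                 else (if ∣ U ∣ ℕ.≤ᵇ suc j then (if isMax c U then 0ℚ else 1ℚ) else draw c)))
              ≡ roundValue (suc j) m k ∣ U ∣
    by-case with k ℕ.≤ᵇ m | ∣ U ∣ ℕ.≤ᵇ suc j in small
    ... | true  | _     = trans (Σ-members U 1ℚ) (*-identityʳ _)
    ... | false | true  = notMax-sum N U
    ... | false | false with n<∣U∣ ← ≤ᵇ-false⇒> small | pos⇒suc ∣ U ∣ (ℕP.≤-trans (ℕ.s≤s ℕ.z≤n) n<∣U∣)
    ...   | s , ∣U∣≡ = trans (draw-sum j s U ∣U∣≡ (ℕP.<⇒≤ (ℕ.s≤s⁻¹ (subst (suc j ℕ.<_) ∣U∣≡ n<∣U∣))))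
                         (cong (λ z → ι z * (1ℚ - frac 1 (suc j))) (sym ∣U∣≡))

  roundValue-observe : ∀ n m k s → k ℕ.≤ m → roundValue n m k s ≡ ι s
  roundValue-observe n m k s k≤m rewrite ≤ᵇ-true k≤m = refl

  roundValue-max : ∀ n m k s → m ℕ.< k → s ℕ.≤ n → roundValue n m k s ≡ ι (s ∸ 1)
  roundValue-max n m k s m<k s≤n rewrite ≤ᵇ-false m<k | ≤ᵇ-true s≤n = refl

  roundValue-draw : ∀ n m k s → m ℕ.< k → n ℕ.< s → roundValue n m k s ≡ ι s * (1ℚ - frac 1 n)
  roundValue-draw n m k s m<k n<s rewrite ≤ᵇ-false m<k | ≤ᵇ-false n<s = refl

  freshWord : ∀ {N} → Subset N → List (Fin N) → Bool
  freshWord V bs = distinct bs ∧ not (any (lookup V) bs)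

  fallingFactorial : ℕ → ℕ → ℕ
  fallingFactorial a zero    = 1
  fallingFactorial a (suc r) = a ℕ.* fallingFactorial (ℕ.pred a) r

  fallingFactorial-pos : ∀ a → 1 ℕ.≤ fallingFactorial a a
  fallingFactorial-pos zero    = ℕ.s≤s ℕ.z≤n
  fallingFactorial-pos (suc a) = ℕP.≤-trans (fallingFactorial-pos a) (ℕP.m≤m+n (fallingFactorial a a) _)

  freshWord-∷ : ∀ {N} (V : Subset N) x bs → freshWord V (x ∷ bs) ≡ (not (lookup V x) ∧ freshWord (V ∪ ⁅ x ⁆) bs)
  freshWord-∷ V x bs =
    trans (regroup (any (x ==F_) bs) (distinct bs) (lookup V x) (any (lookup V) bs))
      (cong (λ u → not (lookup V x) ∧ (distinct bs ∧ not u)) (sym avoid-V∪x))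
    where
    avoid-V∪x : any (lookup (V ∪ ⁅ x ⁆)) bs ≡ (any (lookup V) bs ∨ any (x ==F_) bs)
    avoid-V∪x = trans (any-cong bs (λ y → trans (lookup-∪ V ⁅ x ⁆ y) (cong (lookup V y ∨_) (trans (lookup-⁅⁆ x y) (==F-sym y x)))))
                  (any-∨ (lookup V) (x ==F_) bs)
    regroup : ∀ a d v w → ((not a ∧ d) ∧ not (v ∨ w)) ≡ (not v ∧ (d ∧ not (w ∨ a)))
    regroup a     d true  w     = ∧-false (not a ∧ d)
    regroup true  d false true  = sym (∧-false d)
    regroup true  d false false = sym (∧-false d)
    regroup false d false true  = refl
    regroup false d false false = refl

  countFresh : ∀ {N} r (V : Subset N) →
    Σ (allLists (allFin N) r) (λ bs → ind (freshWord V bs) 1ℚ) ≡ ι (fallingFactorial (N ∸ ∣ V ∣) r)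
  countFresh zero V = trans (+-identityʳ 1ℚ) (sym ι-1)
  countFresh {N} (suc r) V =
    trans (Σ-words-suc (allFin N) r _)
      (trans (Σ-cong (allFin N) (λ x →
               trans (Σ-cong (allLists (allFin N) r) (λ bs →
                        trans (cong (λ u → ind u 1ℚ) (freshWord-∷ V x bs)) (ind-∧ (not (lookup V x)) _ _)))
                 (trans (Σ-ind (allLists (allFin N) r) (not (lookup V x)) _)
                   (cong (ind (not (lookup V x))) (countFresh r (V ∪ ⁅ x ⁆))))))
        (trans (Σ-allFin N _)
          (trans (sumFin-restrict (λ c → not (lookup V c)) _ (λ _ → ι (fallingFactorial (N ∸ suc ∣ V ∣) r))
                   (λ c e → cong (λ z → ι (fallingFactorial (N ∸ z) r)) (∣∪⁅⁆∣ V c (not-true e))))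
            (trans (Σ-nonmembers V _)
              (trans (sym (ι-* (N ∸ ∣ V ∣) _))
                (cong (λ z → ι ((N ∸ ∣ V ∣) ℕ.* fallingFactorial z r)) (sym (ℕP.pred[m∸n]≡m∸[1+n] N ∣ V ∣))))))))

  -- Cutting the arrival order after ℓ letters, an
  -- outcome with S_ℓ = U is a path to U followed by a fresh word avoiding U, so
  -- sums of prefix functionals over the event factor as (path sum) · (#suffixes).

  module Conditioning (n h ℓ : ℕ) (U : Subset (n ℕ.+ h)) (ℓ≤n : ℓ ℕ.≤ n) where

    private
      N : ℕ
      N = n ℕ.+ h
      letters : List (Fin N)
      letters = allFin N

    validOutcome : Subset N × List (Fin N) → Bool
    validOutcome ω = (∣ proj₁ ω ∣ ℕ.≡ᵇ h) ∧ distinct (proj₂ ω) ∧ not (any (λ c → c ∈ᵇ proj₁ ω) (proj₂ ω))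

    suffixCount : ℕ
    suffixCount = fallingFactorial (N ∸ ∣ U ∣) (n ∸ ℓ)

    split-outcome : ∀ H as bs →
      ((length as ℕ.≡ᵇ ℓ) ∧ (validOutcome (H , as ++ bs) ∧ eqSubset (H ∪ fromList as) U))
        ≡ (pathTo h ℓ U H as ∧ freshWord U bs)
    split-outcome H as bs with eqSubset (H ∪ fromList as) U in reaches-U
    ... | false = trans (cong ((length as ℕ.≡ᵇ ℓ) ∧_) (∧-false (validOutcome (H , as ++ bs))))
                    (trans (∧-false (length as ℕ.≡ᵇ ℓ))
                      (sym (cong (_∧ freshWord U bs) (prefix-false (length as ℕ.≡ᵇ ℓ) (∣ H ∣ ℕ.≡ᵇ h) _))))
      where
      prefix-false : ∀ L hH X → (L ∧ (hH ∧ (X ∧ false))) ≡ false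
      prefix-false L hH X = trans (cong (λ u → L ∧ (hH ∧ u)) (∧-false X))
                              (trans (cong (L ∧_) (∧-false hH)) (∧-false L))
    ... | true =
      trans (cong₂ (λ u v → (length as ℕ.≡ᵇ ℓ) ∧ (((∣ H ∣ ℕ.≡ᵇ h) ∧ (u ∧ not v)) ∧ true))
                   (distinct-++ as bs) (any-++ (lookup H) as bs))
        (trans (regroup (length as ℕ.≡ᵇ ℓ) (∣ H ∣ ℕ.≡ᵇ h) (distinct as) (distinct bs) in-prefix (any (lookup H) as) (any (lookup H) bs))
          (cong (λ u → ((length as ℕ.≡ᵇ ℓ) ∧ ((∣ H ∣ ℕ.≡ᵇ h) ∧ ((distinct as ∧ not (any (lookup H) as)) ∧ true))) ∧ (distinct bs ∧ not u))
                (sym avoid-U)))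
      where
      in-prefix : Bool
      in-prefix = any (λ y → any (y ==F_) as) bs
      avoid-U : any (lookup U) bs ≡ (any (lookup H) bs ∨ in-prefix)
      avoid-U = trans (any-cong bs (λ y → trans (cong (λ Z → lookup Z y) (sym (eqSubset-sound (H ∪ fromList as) U reaches-U)))
                                                 (lookup-∪-fromList H as y)))
                  (any-∨ (lookup H) (λ y → any (y ==F_) as) bs)
      regroup : ∀ L hH dA dB X hA hB →
        (L ∧ ((hH ∧ ((dA ∧ (dB ∧ not X)) ∧ not (hA ∨ hB))) ∧ true))
          ≡ ((L ∧ (hH ∧ ((dA ∧ not hA) ∧ true))) ∧ (dB ∧ not (hB ∨ X)))
      regroup false hH    dA    dB    X     hA    hB    = refl
      regroup true  false dA    dB    X     hA    hB    = refl
      regroup true  true  false dB    X     hA    hB    = refl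
      regroup true  true  true  false X     true  hB    = refl
      regroup true  true  true  false X     false hB    = refl
      regroup true  true  true  true  true  true  hB    = refl
      regroup true  true  true  true  false true  hB    = refl
      regroup true  true  true  true  true  false true  = refl
      regroup true  true  true  true  true  false false = refl
      regroup true  true  true  true  false false true  = refl
      regroup true  true  true  true  false false false = refl

    orders-sum : ∀ (F : Subset N → List (Fin N) → ℚ) H →
      Σ (allLists letters n) (λ cs → ind (validOutcome (H , cs)) (ind (eqSubset (H ∪ fromList (take ℓ cs)) U) (F H (take ℓ cs))))
        ≡ Σ (allLists letters ℓ) (λ as → ind (pathTo h ℓ U H as) (F H as)) * ι suffixCount
    orders-sum F H = subst (λ k → Σ (allLists letters k) summand ≡ Σ (allLists letters ℓ) (λ as → ind (pathTo h ℓ U H as) (F H as)) * ι suffixCount) (ℕP.m+[n∸m]≡n ℓ≤n) cut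
      where
      summand : List (Fin N) → ℚ
      summand cs = ind (validOutcome (H , cs)) (ind (eqSubset (H ∪ fromList (take ℓ cs)) U) (F H (take ℓ cs)))
      G : List (Fin N) → List (Fin N) → ℚ
      G as bs = ind (validOutcome (H , as ++ bs)) (ind (eqSubset (H ∪ fromList as) U) (F H as))
      factor : ∀ as bs → ind (length as ℕ.≡ᵇ ℓ) (G as bs) ≡ ind (pathTo h ℓ U H as) (F H as) * ind (freshWord U bs) 1ℚ
      factor as bs =
        trans (sym (trans (ind-∧ (length as ℕ.≡ᵇ ℓ) _ _) (cong (ind (length as ℕ.≡ᵇ ℓ)) (ind-∧ (validOutcome (H , as ++ bs)) _ _))))
          (trans (cong (λ u → ind u (F H as)) (split-outcome H as bs)) (sym (ind-*-ind (pathTo h ℓ U H as) (freshWord U bs) (F H as))))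
      cut : Σ (allLists letters (ℓ ℕ.+ (n ∸ ℓ))) summand
              ≡ Σ (allLists letters ℓ) (λ as → ind (pathTo h ℓ U H as) (F H as)) * ι suffixCount
      cut =
        trans (Σ-cong (allLists letters (ℓ ℕ.+ (n ∸ ℓ)))
                (λ cs → cong (λ z → ind (validOutcome (H , z)) (ind (eqSubset (H ∪ fromList (take ℓ cs)) U) (F H (take ℓ cs))))
                             (sym (ListP.take++drop≡id ℓ cs))))
          (trans (Σ-words-split letters ℓ (n ∸ ℓ) G)
            (trans (Σ-words-length letters ℓ _)
              (trans (Σ-cong (allLists letters ℓ) (λ as →
                        trans (sym (Σ-ind (allLists letters (n ∸ ℓ)) (length as ℕ.≡ᵇ ℓ) (G as)))
                          (trans (Σ-cong (allLists letters (n ∸ ℓ)) (factor as))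
                            (trans (Σ-*ˡ (allLists letters (n ∸ ℓ)) (ind (pathTo h ℓ U H as) (F H as)) _)
                              (cong (ind (pathTo h ℓ U H as) (F H as) *_) (countFresh (n ∸ ℓ) U))))))
                (Σ-*ʳ (allLists letters ℓ) (ι suffixCount) _))))

    conditioned-sum : ∀ (F : Subset N → List (Fin N) → ℚ) →
      Σ (outcomes n h) (λ ω → ind (eqSubset (Sℓ ω ℓ) U) (F (proj₁ ω) (take ℓ (proj₂ ω)))) ≡ pathSum h ℓ U F * ι suffixCount
    conditioned-sum F =
      trans (Σ-filter (cartesianProduct (allSubsets N) (allLists letters n)) validOutcome _)
        (trans (Σ-cartesian (allSubsets N) (allLists letters n) _)
          (trans (Σ-cong (allSubsets N) (orders-sum F)) (Σ-*ʳ (allSubsets N) (ι suffixCount) _)))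

  -- The closed form for n = j + 1.  With a = n - h, the rejection path sum
  -- R₁⋯R_ℓ relates to the path count (h+1)⋯(h+ℓ) by three regimes:
  -- equal for ℓ ≤ m, telescoping (h+m)/(h+ℓ) for m ≤ ℓ ≤ a, and a further
  -- factor (1 - 1/n) per round beyond a.
  module ClosedForm (j m h : ℕ) (h≤j : h ℕ.≤ j) (m≤a : m ℕ.≤ suc j ∸ h) where

    private
      n a : ℕ
      n = suc j
      a = n ∸ h
      r : ℚ
      r = frac 1 n
      h+a≡n : h ℕ.+ a ≡ n
      h+a≡n = ℕP.m+[n∸m]≡n (ℕP.m≤n⇒m≤1+n h≤j)

    R : ℕ → ℚ
    R k = roundValue n m k (h ℕ.+ k)

    open RejectionPathSum n m h {N = n ℕ.+ h} R
           (λ k U ∣U∣ → trans (round-sum j m k U) (cong (roundValue n m k) ∣U∣)) public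

    below-threshold : ∀ k → k ℕ.≤ m → prodR k ≡ ι (arrangements h k)
    below-threshold zero    _   = sym ι-1
    below-threshold (suc k) k<m =
      trans (cong₂ _*_ (below-threshold k (ℕP.≤-trans (ℕP.n≤1+n k) k<m)) (roundValue-observe n m (suc k) _ k<m))
        (trans (*-comm (ι (arrangements h k)) (ι (h ℕ.+ suc k))) (sym (ι-* (h ℕ.+ suc k) (arrangements h k))))

    telescoping : ∀ k → m ℕ.≤ k → k ℕ.≤ a → prodR k * ι (h ℕ.+ k) ≡ ι (h ℕ.+ m) * ι (arrangements h k)
    telescoping k m≤k k≤a with ℕP.m≤n⇒m<n∨m≡n m≤k
    ... | inj₂ refl = trans (cong (_* ι (h ℕ.+ m)) (below-threshold m ℕP.≤-refl)) (*-comm (ι (arrangements h m)) (ι (h ℕ.+ m)))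
    telescoping (suc k) m≤k k≤a | inj₁ m<k =
      begin
        prodR k * R (suc k) * ι (h ℕ.+ suc k)
      ≡⟨ cong (λ z → prodR k * z * ι (h ℕ.+ suc k))
              (trans (roundValue-max n m (suc k) _ m<k (subst (h ℕ.+ suc k ℕ.≤_) h+a≡n (ℕP.+-monoʳ-≤ h k≤a)))
                     (cong (λ z → ι (z ∸ 1)) (ℕP.+-suc h k))) ⟩
        prodR k * ι (h ℕ.+ k) * ι (h ℕ.+ suc k)
      ≡⟨ cong (_* ι (h ℕ.+ suc k)) (telescoping k (ℕ.s≤s⁻¹ m<k) (ℕP.≤-trans (ℕP.n≤1+n k) k≤a)) ⟩
        ι (h ℕ.+ m) * ι (arrangements h k) * ι (h ℕ.+ suc k)
      ≡⟨ solve 3 (λ C W A → (C :* W) :* A := C :* (A :* W)) refl (ι (h ℕ.+ m)) (ι (arrangements h k)) (ι (h ℕ.+ suc k)) ⟩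
        ι (h ℕ.+ m) * (ι (h ℕ.+ suc k) * ι (arrangements h k))
      ≡⟨ cong (ι (h ℕ.+ m) *_) (sym (ι-* (h ℕ.+ suc k) (arrangements h k))) ⟩
        ι (h ℕ.+ m) * ι (arrangements h (suc k))
      ∎
      where open ≡-Reasoning

    beyond-threshold : ∀ t → prodR (a ℕ.+ t) * ι n ≡ ι (h ℕ.+ m) * ι (arrangements h (a ℕ.+ t)) * powℚ (1ℚ - r) t
    beyond-threshold zero rewrite ℕP.+-identityʳ a =
      trans (cong (λ z → prodR a * ι z) (sym h+a≡n)) (trans (telescoping a m≤a ℕP.≤-refl) (sym (*-identityʳ _)))
    beyond-threshold (suc t) rewrite ℕP.+-suc a t =
      begin
        prodR k * R (suc k) * ι n
      ≡⟨ cong (λ z → prodR k * z * ι n) (roundValue-draw n m (suc k) _ (ℕ.s≤s (ℕP.≤-trans m≤a (ℕP.m≤m+n a t))) n<h+k+1) ⟩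
        prodR k * (A * (1ℚ - r)) * ι n
      ≡⟨ solve 4 (λ x A r n → (x :* (A :* (con 1ℚ :- r))) :* n := (x :* n) :* (A :* (con 1ℚ :- r))) refl (prodR k) A r (ι n) ⟩
        prodR k * ι n * (A * (1ℚ - r))
      ≡⟨ cong (_* (A * (1ℚ - r))) (beyond-threshold t) ⟩
        C * W * p * (A * (1ℚ - r))
      ≡⟨ solve 5 (λ C W p A r → ((C :* W) :* p) :* (A :* (con 1ℚ :- r)) := (C :* (A :* W)) :* ((con 1ℚ :- r) :* p)) refl C W p A r ⟩
        C * (A * W) * ((1ℚ - r) * p)
      ≡⟨ cong (λ z → C * z * ((1ℚ - r) * p)) (sym (ι-* (h ℕ.+ suc k) (arrangements h k))) ⟩
        C * ι (arrangements h (suc k)) * ((1ℚ - r) * p)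
      ∎
      where
      open ≡-Reasoning
      k : ℕ
      k = a ℕ.+ t
      A C W p : ℚ
      A = ι (h ℕ.+ suc k)
      C = ι (h ℕ.+ m)
      W = ι (arrangements h k)
      p = powℚ (1ℚ - r) t
      n<h+k+1 : n ℕ.< h ℕ.+ suc k
      n<h+k+1 = subst (n ℕ.<_) (sym (ℕP.+-suc h k)) (ℕ.s≤s (subst (ℕ._≤ h ℕ.+ k) h+a≡n (ℕP.+-monoʳ-≤ h (ℕP.m≤m+n a t))))

    target : ℕ → ℚ
    target ℓ = frac (h ℕ.+ m) n * powℚ (1ℚ - r) (ℓ ∸ a)

    closed-form : ∀ ℓ → a ℕ.≤ ℓ → prodR ℓ ≡ ι (arrangements h ℓ) * target ℓ
    closed-form ℓ a≤ℓ =
      begin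
        prodR ℓ                           ≡⟨ sym (trans (cong (prodR ℓ *_) (frac-inverse j)) (*-identityʳ _)) ⟩
        prodR ℓ * (r * ι n)               ≡⟨ solve 3 (λ x r n → x :* (r :* n) := (x :* n) :* r) refl (prodR ℓ) r (ι n) ⟩
        prodR ℓ * ι n * r                 ≡⟨ cong (_* r) beyond ⟩
        C * W * p * r                     ≡⟨ cong (λ z → z * W * p * r) (sym (frac-cancel (h ℕ.+ m) j)) ⟩
        fr * ι n * W * p * r              ≡⟨ solve 5 (λ fr n W p r → (((fr :* n) :* W) :* p) :* r := (W :* (fr :* p)) :* (r :* n)) refl fr (ι n) W p r ⟩
        W * (fr * p) * (r * ι n)          ≡⟨ trans (cong (W * (fr * p) *_) (frac-inverse j)) (*-identityʳ _) ⟩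
        W * (fr * p)
      ∎
      where
      open ≡-Reasoning
      C W p fr : ℚ
      C = ι (h ℕ.+ m)
      W = ι (arrangements h ℓ)
      p = powℚ (1ℚ - r) (ℓ ∸ a)
      fr = frac (h ℕ.+ m) n
      beyond : prodR ℓ * ι n ≡ C * W * p
      beyond = subst (λ z → prodR z * ι n ≡ C * ι (arrangements h z) * p) (ℕP.m+[n∸m]≡n a≤ℓ) (beyond-threshold (ℓ ∸ a))

  mean-of-ratio : ∀ (xs : List ℚ) W K t → sumℚ xs ≡ ι W * t * ι K → length xs ≡ W ℕ.* K → 1 ℕ.≤ W ℕ.* K → mean xs ≡ t
  mean-of-ratio [] W K t total len pos with subst (1 ℕ.≤_) (sym len) pos
  ... | ()
  mean-of-ratio xs@(_ ∷ rest) W K t total len pos =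
    begin
      sumℚ xs * frac 1 L                        ≡⟨ cong (_* frac 1 L) total ⟩
      ι W * t * ι K * frac 1 L                  ≡⟨ solve 4 (λ W t K f → W :* t :* K :* f := t :* (f :* (W :* K))) refl (ι W) t (ι K) (frac 1 L) ⟩
      t * (frac 1 L * (ι W * ι K))              ≡⟨ cong (λ z → t * (frac 1 L * z)) (trans (sym (ι-* W K)) (cong ι (sym len))) ⟩
      t * (frac 1 L * ι L)                      ≡⟨ trans (cong (t *_) (frac-inverse (length rest))) (*-identityʳ t) ⟩
      t
    ∎
    where
    open ≡-Reasoning
    L : ℕ
    L = length xs

  outside-count : ∀ n h ℓ (U : Subset (n ℕ.+ h)) → ∣ U ∣ ≡ h ℕ.+ ℓ → (n ℕ.+ h) ∸ ∣ U ∣ ≡ n ∸ ℓ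
  outside-count n h ℓ U ∣U∣ =
    trans (cong ((n ℕ.+ h) ∸_) ∣U∣) (trans (cong (ℕ._∸ (h ℕ.+ ℓ)) (ℕP.+-comm n h)) (ℕP.[m+n]∸[m+o]≡n∸o h n ℓ))

open import Defs
open import Data.Nat using (ℕ; _+_; _∸_; _≤_)
open import Data.Fin.Subset using (Subset; ∣_∣)
open import Data.Rational using (ℚ; 1ℚ) renaming (_*_ to _*ℚ_; _-_ to _-ℚ_)
open import Relation.Binary.PropositionalEquality using (_≡_)

open import Data.Nat using (suc; _*_; s≤s; z≤n)
open import Data.Nat.Properties using (*-mono-≤)
open import Data.Bool using (Bool)
open import Data.Fin using (Fin)
open import Data.List using (List; filterᵇ; length; map)
open import Data.Product using (_×_)
open import Data.List.Properties using (length-map)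
open import Relation.Binary.PropositionalEquality using (trans; sym; cong; subst)
open Proof

-- The conditional probability is (rejection path sum) · K / ((number of paths) · K),
-- and the rejection path sum is the number of paths times the target value.
lemma4 : (n h m : ℕ) → 1 ≤ n → h ≤ n ∸ 1 → m ≤ n ∸ h →
    (ℓ : ℕ) → n ∸ h ≤ ℓ → ℓ ≤ n →
    (U : Subset (n + h)) → ∣ U ∣ ≡ h + ℓ →
    condProbNoAccept n h m ℓ U
    ≡ frac (h + m) n *ℚ powℚ (1ℚ -ℚ frac 1 n) (ℓ ∸ (n ∸ h))
lemma4 (suc j) h m (s≤s z≤n) h≤j m≤a ℓ a≤ℓ ℓ≤n U ∣U∣ =
  mean-of-ratio (map reject conditioned) (arrangements h ℓ) suffixCount (target ℓ) total count positive
  where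
  open ClosedForm j m h h≤j m≤a
  open Conditioning (suc j) h ℓ U ℓ≤n
  Outcome : Set
  Outcome = Subset (suc j + h) × List (Fin (suc j + h))
  event : Outcome → Bool
  event ω = eqSubset (Sℓ ω ℓ) U
  reject : Outcome → ℚ
  reject ω = noAcceptUpTo (suc j) h m ω ℓ
  conditioned : List Outcome
  conditioned = filterᵇ event (outcomes (suc j) h)
  total : sumℚ (map reject conditioned) ≡ ι (arrangements h ℓ) *ℚ target ℓ *ℚ ι suffixCount
  total = trans (Σ-filter (outcomes (suc j) h) event reject)
            (trans (conditioned-sum (rejectAll (suc j) m 1))
              (cong (_*ℚ ι suffixCount) (trans (rejectionPathSum ℓ U ∣U∣) (closed-form ℓ a≤ℓ))))
  count : length (map reject conditioned) ≡ arrangements h ℓ * suffixCount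
  count = trans (length-map reject conditioned)
            (ι-injective _ _ (trans (length-filter event (outcomes (suc j) h))
              (trans (conditioned-sum (λ _ _ → 1ℚ))
                (trans (cong (_*ℚ ι suffixCount) (pathCount h ℓ U ∣U∣)) (sym (ι-* (arrangements h ℓ) suffixCount))))))
  positive : 1 ≤ arrangements h ℓ * suffixCount
  positive = *-mono-≤ {1} {arrangements h ℓ} {1} (arrangements-pos h ℓ)
               (subst (λ a → 1 ≤ fallingFactorial a (suc j ∸ ℓ)) (sym (outside-count (suc j) h ℓ U ∣U∣))
                 (fallingFactorial-pos (suc j ∸ ℓ)))
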